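{- Let $G$ be a looped simple graph. The following conditions are equivalent: (1) $G$ is locally equivalent to a bipartite graph; (2) $G$ has a pair of disjoint transversals $T_1,T_2$ with $r(T_1)+r(T_2)=|V(G)|$, ranks taken in $M[IAS(G)]$; (3) $G$ has a pair of disjoint transversals $T_1,T_2$ with $M[IAS(G)]\mid(T_1\cup T_2)=(M[IAS(G)]\mid T_1)\oplus(M[IAS(G)]\mid T_2)$; (4) $G$ has a pair of disjoint transversals $T_1,T_2$ with $M[IAS(G)]\mid T_1\cong(M[IAS(G)]\mid T_2)^{*}$.
   Context: A looped simple graph is a finite graph with loops allowed but no two edges on the same set of end-vertices; neighbors are distinct adjacent vertices. A bipartite graph here has no loops and its vertices split into two classes with every edge joining the classes. $A(G)$ is the adjacency matrix over $GF(2)$ with diagonal entry $1$ exactly at looped vertices. $IAS(G)=(I\;A(G)\;A(G)+I)$ over $GF(2)$, with $v$ columns labeled $\phi_G(v),\chi_G(v),\psi_G(v)$; $W(G)$ is the set of labels and $M[IAS(G)]$ the binary matroid on $W(G)$ represented by $IAS(G)$. A transversal is a subset of $W(G)$ containing exactly one element of each vertex triple $\{\phi_G(v),\chi_G(v),\psi_G(v)\}$. $\oplus$ denotes direct sum of matroids on disjoint ground sets and $^{*}$ the dual matroid. Local equivalence: $G^v_\ell$ complements the loop status of $v$; $G^v_s$ complements the adjacency status of every pair of distinct neighbors of $v$; $G^v_{ns}$ does the same and also complements the loop status of every neighbor of $v$; $H$ is locally equivalent to $G$ if obtained from $G$ by a finite sequence of such operations. -}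

module Defs where

open import Data.Bool using (Bool; true; false; not; _∧_; _xor_; if_then_else_)
open import Data.Nat using (ℕ; zero; suc; _+_; _≤_)
open import Data.Fin using (Fin; zero; suc; _≟_)
open import Data.Product using (Σ; ∃; ∃-syntax; _×_; _,_)
open import Relation.Nullary using (¬_)
open import Relation.Nullary.Decidable using (⌊_⌋)
open import Relation.Binary.PropositionalEquality using (_≡_; _≢_)

-- Looped simple graphs on the vertex set Fin n, given by their
-- adjacency matrix A(G) over GF(2) = Bool (diagonal entry true exactly
-- at looped vertices).

Adj : ℕ → Set
Adj n = Fin n → Fin n → Bool

Symmetric : ∀ {n} → Adj n → Set
Symmetric A = ∀ i j → A i j ≡ A j i

_==_ : ∀ {n} → Fin n → Fin n → Bool
i == j = ⌊ i ≟ j ⌋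

isNbr : ∀ {n} → Adj n → Fin n → Fin n → Bool
isNbr A v u = not (u == v) ∧ A u v

opLoop : ∀ {n} → Fin n → Adj n → Adj n
opLoop v A i j = if (i == v) ∧ (j == v) then not (A i j) else A i j

opS : ∀ {n} → Fin n → Adj n → Adj n
opS v A i j =
  if not (i == j) ∧ isNbr A v i ∧ isNbr A v j then not (A i j) else A i j

opNS : ∀ {n} → Fin n → Adj n → Adj n
opNS v A i j =
  if isNbr A v i ∧ isNbr A v j then not (A i j) else A i j

data LocEq {n : ℕ} (G : Adj n) : Adj n → Set where
  leRefl : LocEq G G
  leLoop : ∀ {H} v → LocEq G H → LocEq G (opLoop v H)
  leS    : ∀ {H} v → LocEq G H → LocEq G (opS v H)
  leNS   : ∀ {H} v → LocEq G H → LocEq G (opNS v H)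

Bipartite : ∀ {n} → Adj n → Set
Bipartite {n} A =
  (∀ i → A i i ≡ false) ×
  Σ (Fin n → Bool) (λ c → ∀ i j → A i j ≡ true → c i ≢ c j)

data Label : Set where
  φ χ ψ : Label

Elem : ℕ → Set
Elem n = Fin n × Label

-- column of IAS(G) = (I  A  A+I) labelled by an element of W(G)
col : ∀ {n} → Adj n → Elem n → Fin n → Bool
col A (v , φ) i = i == v
col A (v , χ) i = A i v
col A (v , ψ) i = A i v xor (i == v)

Sub : ℕ → Set
Sub n = Elem n → Bool

_∈_ : ∀ {n} → Elem n → Sub n → Set
w ∈ S = S w ≡ true

_⊆_ : ∀ {n} → Sub n → Sub n → Set
S ⊆ T = ∀ w → w ∈ S → w ∈ T

_∪_ : ∀ {n} → Sub n → Sub n → Sub n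
(S ∪ T) w = S w Data.Bool.∨ T w

_∩_ : ∀ {n} → Sub n → Sub n → Sub n
(S ∩ T) w = S w ∧ T w

Disjoint : ∀ {n} → Sub n → Sub n → Set
Disjoint S T = ∀ w → ¬ (w ∈ S × w ∈ T)

xorFin : ∀ {n} → (Fin n → Bool) → Bool
xorFin {zero}  f = false
xorFin {suc n} f = f zero xor xorFin (λ i → f (suc i))

sumFin : ∀ {n} → (Fin n → ℕ) → ℕ
sumFin {zero}  f = 0
sumFin {suc n} f = f zero + sumFin (λ i → f (suc i))

xorL : (Label → Bool) → Bool
xorL f = f φ xor (f χ xor f ψ)

sumL : (Label → ℕ) → ℕ
sumL f = f φ + (f χ + f ψ)

card : ∀ {n} → Sub n → ℕ
card S = sumFin (λ v → sumL (λ l → if S (v , l) then 1 else 0))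

sumCols : ∀ {n} → Adj n → Sub n → Fin n → Bool
sumCols A D i = xorFin (λ v → xorL (λ l → D (v , l) ∧ col A (v , l) i))

Independent : ∀ {n} → Adj n → Sub n → Set
Independent A S =
  ∀ D → D ⊆ S → (∃[ w ] w ∈ D) → ¬ (∀ i → sumCols A D i ≡ false)

IsRank : ∀ {n} → Adj n → Sub n → ℕ → Set
IsRank A S k =
  (∃[ I ] (I ⊆ S × Independent A I × card I ≡ k)) ×
  (∀ I → I ⊆ S → Independent A I → card I ≤ k)

Transversal : ∀ {n} → Sub n → Set
Transversal T = ∀ v → sumL (λ l → if T (v , l) then 1 else 0) ≡ 1

IsBasis : ∀ {n} → Adj n → Sub n → Sub n → Set
IsBasis A T B =
  B ⊆ T × Independent A B ×
  (∀ J → B ⊆ J → J ⊆ T → Independent A J → J ⊆ B)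

DualIndependent : ∀ {n} → Adj n → Sub n → Sub n → Set
DualIndependent A T I = I ⊆ T × ∃[ B ] (IsBasis A T B × Disjoint B I)

DirectSumSplit : ∀ {n} → Adj n → Sub n → Sub n → Set
DirectSumSplit A T₁ T₂ =
  ∀ I → I ⊆ (T₁ ∪ T₂) →
    (Independent A I → Independent A (I ∩ T₁) × Independent A (I ∩ T₂)) ×
    (Independent A (I ∩ T₁) × Independent A (I ∩ T₂) → Independent A I)

-- M|T1 ≅ (M|T2)* : a bijection f : T1 → T2 (with inverse g) such that
-- I ⊆ T1 is independent in M|T1 iff f(I) is independent in (M|T2)*
IsoToDual : ∀ {n} → Adj n → Sub n → Sub n → Set
IsoToDual {n} A T₁ T₂ =
  Σ (Elem n → Elem n) λ f → Σ (Elem n → Elem n) λ g →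
    (∀ w → w ∈ T₁ → f w ∈ T₂) ×
    (∀ w → w ∈ T₂ → g w ∈ T₁) ×
    (∀ w → w ∈ T₁ → g (f w) ≡ w) ×
    (∀ w → w ∈ T₂ → f (g w) ≡ w) ×
    (∀ I → I ⊆ T₁ →
      (Independent A I → DualIndependent A T₂ (λ w → T₂ w ∧ I (g w))) ×
      (DualIndependent A T₂ (λ w → T₂ w ∧ I (g w)) → Independent A I))

Cond1 : ∀ {n} → Adj n → Set
Cond1 {n} G = ∃[ H ] (LocEq G H × Bipartite H)

DisjTransversals : ∀ {n} → Sub n → Sub n → Set
DisjTransversals T₁ T₂ = Transversal T₁ × Transversal T₂ × Disjoint T₁ T₂

Cond2 : ∀ {n} → Adj n → Set
Cond2 {n} G = ∃[ T₁ ] ∃[ T₂ ] (DisjTransversals T₁ T₂ ×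
  ∃[ r₁ ] ∃[ r₂ ] (IsRank G T₁ r₁ × IsRank G T₂ r₂ × r₁ + r₂ ≡ n))

Cond3 : ∀ {n} → Adj n → Set
Cond3 G = ∃[ T₁ ] ∃[ T₂ ] (DisjTransversals T₁ T₂ × DirectSumSplit G T₁ T₂)

Cond4 : ∀ {n} → Adj n → Set
Cond4 G = ∃[ T₁ ] ∃[ T₂ ] (DisjTransversals T₁ T₂ × IsoToDual G T₁ T₂)

-- Corollary 4.4.  Conditions (2)–(4) all read "some disjoint transversals
-- T₁, T₂ of M[IAS(G)] satisfy X" (rank sum n, direct sum, duality), and
-- (1) ⇔ (X) follows uniformly (cond1⇔pairCondition) from three facts about X:
--  * invariance: a local operation changes the IAS-columns by label swaps
--    inside vertex triples and an invertible row operation (a similarity),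
--    which preserves independence, ranks, bases, duals and direct sums;
--  * for a proper 2-colouring c of a bipartite graph, the transversals
--    side c = {φ(v) : c v} ∪ {χ(v) : ¬ c v} and side (¬ c) satisfy X;
--  * X implies the rank bound |I| + |K| ≤ n for independent I ⊆ T₁, K ⊆ T₂.
-- For (X) ⇒ (1), local operations reach a normal form (no loops, every φ(v)
-- in T₁ ∪ T₂) where the rank bound forbids edges inside the classes
-- {v : φ(v) ∈ Tᵢ}.
module Submission where

open import Defs
open import Algebra.Bundles using (CommutativeRing)
open import Data.Bool using (Bool; true; false; not; _∧_; _∨_; _xor_; if_then_else_)
import Data.Bool as Bool
open import Data.Bool.Properties
  using ( xor-∧-commutativeRing; xor-identityʳ; xor-same; xor-assoc; xor-comm
        ; ∧-zeroʳ; ∧-identityʳ; ∧-comm; ∧-assoc; ∧-distribˡ-xor; ∧-distribʳ-xor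
        ; ∨-identityʳ; ∨-comm; not-involutive )
open import Data.Empty using (⊥; ⊥-elim)
open import Data.Fin using (Fin; zero; suc; _≟_; toℕ; fromℕ<)
open import Data.Fin.Properties using (any?; suc-injective; toℕ-fromℕ<; toℕ-injective; toℕ<n)
open import Data.List using (List; []; _∷_; allFin)
open import Data.List.Relation.Unary.All as All using (All; []; _∷_)
open import Data.List.Membership.Propositional.Properties using (∈-allFin)
open import Data.Nat using (ℕ; zero; suc; _+_; _≤_; _<_; z≤n; s≤s; s≤s⁻¹)
open import Data.Nat.Properties
  using (+-suc; +-assoc; +-comm; +-identityʳ; +-mono-≤; m≤n⇒m≤1+n; ≤-refl; ≤-trans; <⇒≤; ≤∧≢⇒<; n≮n)
import Data.Nat.Properties as ℕ
open import Data.Nat.Tactic.RingSolver using (solve-∀)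
open import Data.Product using (Σ; ∃; ∃-syntax; _×_; _,_; proj₁; proj₂)
open import Data.Product.Properties using (≡-dec)
open import Data.Sum using (_⊎_; inj₁; inj₂)
open import Function.Base using (_∘_)
open import Function.Bundles using (_⇔_; mk⇔)
open import Relation.Binary.Definitions using (DecidableEquality)
open import Relation.Binary.PropositionalEquality
  using (_≡_; _≢_; refl; sym; trans; cong; cong₂; subst; module ≡-Reasoning)
open import Relation.Nullary using (¬_; Dec; yes; no; _×-dec_)
open import Relation.Nullary.Decidable using (⌊_⌋; isYes≗does; dec-true; dec-false)
open import Algebra.Properties.CommutativeSemigroup
  (CommutativeRing.+-commutativeSemigroup xor-∧-commutativeRing)
  using () renaming (interchange to xor-interchange)


Vector : ℕ → Set
Vector n = Fin n → Bool

Family : ℕ → Set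
Family n = Elem n → Vector n

sumW : ∀ {n} → (Elem n → Bool) → Bool
sumW f = xorFin (λ v → xorL (λ l → f (v , l)))

xorFin-cong : ∀ {n} {f g : Fin n → Bool} → (∀ i → f i ≡ g i) → xorFin f ≡ xorFin g
xorFin-cong {zero}  e = refl
xorFin-cong {suc n} e = cong₂ _xor_ (e zero) (xorFin-cong (λ i → e (suc i)))

xorFin-zero : ∀ {n} (f : Fin n → Bool) → (∀ i → f i ≡ false) → xorFin f ≡ false
xorFin-zero {zero}  f e = refl
xorFin-zero {suc n} f e =
  cong₂ _xor_ (e zero) (xorFin-zero (λ i → f (suc i)) (λ i → e (suc i)))

xorFin-hom : ∀ {n} (f g : Fin n → Bool) →
  xorFin (λ i → f i xor g i) ≡ xorFin f xor xorFin g
xorFin-hom {zero}  f g = refl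
xorFin-hom {suc n} f g =
  trans (cong ((f zero xor g zero) xor_) (xorFin-hom (λ i → f (suc i)) (λ i → g (suc i))))
        (xor-interchange (f zero) (g zero) _ _)

xorFin-scale : ∀ {n} b (f : Fin n → Bool) → xorFin (λ i → b ∧ f i) ≡ b ∧ xorFin f
xorFin-scale {zero}  false f = refl
xorFin-scale {zero}  true  f = refl
xorFin-scale {suc n} b f =
  trans (cong ((b ∧ f zero) xor_) (xorFin-scale b (λ i → f (suc i))))
        (sym (∧-distribˡ-xor b (f zero) _))

xorFin-single : ∀ {n} (v₀ : Fin n) (f : Fin n → Bool) →
  (∀ v → v ≢ v₀ → f v ≡ false) → xorFin f ≡ f v₀
xorFin-single zero f e =
  trans (cong (f zero xor_) (xorFin-zero _ (λ i → e (suc i) (λ ())))) (xor-identityʳ _)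
xorFin-single (suc v₀) f e =
  trans (cong (_xor xorFin (λ i → f (suc i))) (e zero (λ ())))
        (xorFin-single v₀ (λ i → f (suc i)) (λ v v≢ → e (suc v) (λ q → v≢ (suc-injective q))))

xorFin-swap : ∀ {m n} (f : Fin m → Fin n → Bool) →
  xorFin (λ i → xorFin (f i)) ≡ xorFin (λ j → xorFin (λ i → f i j))
xorFin-swap {zero} {n} f = sym (xorFin-zero {n} _ (λ j → refl))
xorFin-swap {suc m} f =
  trans (cong (xorFin (f zero) xor_) (xorFin-swap (λ i → f (suc i))))
        (sym (xorFin-hom (f zero) (λ j → xorFin (λ i → f (suc i) j))))

xorL-cong : {f g : Label → Bool} → (∀ l → f l ≡ g l) → xorL f ≡ xorL g
xorL-cong e = cong₂ _xor_ (e φ) (cong₂ _xor_ (e χ) (e ψ))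

xorL-hom : (f g : Label → Bool) → xorL (λ l → f l xor g l) ≡ xorL f xor xorL g
xorL-hom f g =
  trans (cong ((f φ xor g φ) xor_) (xor-interchange (f χ) (g χ) (f ψ) (g ψ)))
        (xor-interchange (f φ) (g φ) _ _)

xorL-scale : ∀ b (f : Label → Bool) → xorL (λ l → b ∧ f l) ≡ b ∧ xorL f
xorL-scale false f = refl
xorL-scale true  f = refl

xorL-single : (l₀ : Label) (f : Label → Bool) → (∀ l → l ≢ l₀ → f l ≡ false) → xorL f ≡ f l₀
xorL-single φ f e = trans (cong₂ (λ a b → f φ xor (a xor b)) (e χ (λ ())) (e ψ (λ ()))) (xor-identityʳ _)
xorL-single χ f e = trans (cong₂ (λ a b → a xor (f χ xor b)) (e φ (λ ())) (e ψ (λ ()))) (xor-identityʳ _)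
xorL-single ψ f e = cong₂ (λ a b → a xor (b xor f ψ)) (e φ (λ ())) (e χ (λ ()))

xorL-xorFin : ∀ {n} (f : Label → Fin n → Bool) →
  xorL (λ l → xorFin (f l)) ≡ xorFin (λ j → xorL (λ l → f l j))
xorL-xorFin f =
  trans (cong (xorFin (f φ) xor_) (sym (xorFin-hom (f χ) (f ψ)))) (sym (xorFin-hom (f φ) _))

sumW-cong : ∀ {n} {f g : Elem n → Bool} → (∀ w → f w ≡ g w) → sumW f ≡ sumW g
sumW-cong e = xorFin-cong (λ v → xorL-cong (λ l → e (v , l)))

sumW-zero : ∀ {n} (f : Elem n → Bool) → (∀ w → f w ≡ false) → sumW f ≡ false
sumW-zero f e = xorFin-zero _ (λ v → xorL-cong {g = λ _ → false} (λ l → e (v , l)))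

sumW-hom : ∀ {n} (f g : Elem n → Bool) → sumW (λ w → f w xor g w) ≡ sumW f xor sumW g
sumW-hom {n} f g = trans (xorFin-cong (λ v → xorL-hom (λ l → f (v , l)) (λ l → g (v , l))))
                         (xorFin-hom {n} _ _)

sumW-scale : ∀ {n} b (f : Elem n → Bool) → sumW (λ w → b ∧ f w) ≡ b ∧ sumW f
sumW-scale {n} b f = trans (xorFin-cong (λ v → xorL-scale b (λ l → f (v , l)))) (xorFin-scale {n} b _)

sumW-single : ∀ {n} (w₀ : Elem n) (f : Elem n → Bool) →
  (∀ w → w ≢ w₀ → f w ≡ false) → sumW f ≡ f w₀
sumW-single (v₀ , l₀) f e =
  trans (xorFin-single v₀ _ (λ v v≢ → xorL-cong {g = λ _ → false} (λ l → e (v , l) (λ q → v≢ (cong proj₁ q)))))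
        (xorL-single l₀ _ (λ l l≢ → e (v₀ , l) (λ q → l≢ (cong proj₂ q))))

sumW-xorFin : ∀ {m n} (f : Elem m → Fin n → Bool) →
  sumW (λ w → xorFin (f w)) ≡ xorFin (λ j → sumW (λ w → f w j))
sumW-xorFin f = trans (xorFin-cong (λ v → xorL-xorFin (λ l → f (v , l))))
                      (xorFin-swap (λ v j → xorL (λ l → f (v , l) j)))

module EqualityTest {A : Set} (_≟ᴬ_ : DecidableEquality A) where

  test-refl : ∀ x → ⌊ x ≟ᴬ x ⌋ ≡ true
  test-refl x = trans (isYes≗does (x ≟ᴬ x)) (dec-true (x ≟ᴬ x) refl)

  test-distinct : ∀ {x y} → x ≢ y → ⌊ x ≟ᴬ y ⌋ ≡ false
  test-distinct {x} {y} x≢y = trans (isYes≗does (x ≟ᴬ y)) (dec-false (x ≟ᴬ y) x≢y)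

  test-sound : ∀ {x y} → ⌊ x ≟ᴬ y ⌋ ≡ true → x ≡ y
  test-sound {x} {y} h with x ≟ᴬ y
  ... | yes x≡y = x≡y

  -- case distinction on equality; unlike matching on x ≟ᴬ y it does not
  -- rewrite occurrences of the test ⌊ x ≟ᴬ y ⌋ in the goal
  compare : ∀ x y → (x ≡ y) ⊎ (x ≢ y)
  compare x y with x ≟ᴬ y
  ... | yes x≡y = inj₁ x≡y
  ... | no x≢y  = inj₂ x≢y

  test-sym : ∀ x y → ⌊ x ≟ᴬ y ⌋ ≡ ⌊ y ≟ᴬ x ⌋
  test-sym x y with x ≟ᴬ y
  ... | yes refl = sym (test-refl x)
  ... | no x≢y   = sym (test-distinct (λ y≡x → x≢y (sym y≡x)))

open module VertexTest {n} = EqualityTest (_≟_ {n})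
  renaming (test-refl to ==-refl; test-distinct to ==-distinct; test-sound to ==-sound; test-sym to ==-sym; compare to compareV)

_≟L_ : DecidableEquality Label
φ ≟L φ = yes refl
χ ≟L χ = yes refl
ψ ≟L ψ = yes refl
φ ≟L χ = no (λ ())
φ ≟L ψ = no (λ ())
χ ≟L φ = no (λ ())
χ ≟L ψ = no (λ ())
ψ ≟L φ = no (λ ())
ψ ≟L χ = no (λ ())

_≟W_ : ∀ {n} → DecidableEquality (Elem n)
_≟W_ = ≡-dec _≟_ _≟L_

_==W_ : ∀ {n} → Elem n → Elem n → Bool
w ==W u = ⌊ w ≟W u ⌋

open module ElemTest {n} = EqualityTest (_≟W_ {n})
  using () renaming (test-refl to ==W-refl; test-distinct to ==W-distinct; test-sound to ==W-sound; compare to compareW)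

∧-true : ∀ {a b} → a ∧ b ≡ true → (a ≡ true) × (b ≡ true)
∧-true {true} {true} refl = refl , refl

∧-intro : ∀ {a b} → a ≡ true → b ≡ true → a ∧ b ≡ true
∧-intro refl refl = refl

∨-true : ∀ {a b} → a ∨ b ≡ true → (a ≡ true) ⊎ (b ≡ true)
∨-true {true}         refl = inj₁ refl
∨-true {false} {true} refl = inj₂ refl

∨-introˡ : ∀ {a b} → a ≡ true → a ∨ b ≡ true
∨-introˡ refl = refl

∨-introʳ : ∀ {a b} → b ≡ true → a ∨ b ≡ true
∨-introʳ {true}  refl = refl
∨-introʳ {false} refl = refl

false≢true : false ≢ true
false≢true ()

not-true : ∀ {a} → not a ≡ true → a ≡ false
not-true {false} refl = refl

xor-true : ∀ {a b} → a ≡ true → a xor b ≡ false → b ≡ true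
xor-true {b = true} refl refl = refl

singleton : ∀ {n} → Elem n → Sub n
singleton w₀ w = w ==W w₀

singleton-⊆ : ∀ {n} {S : Sub n} {w₀} → w₀ ∈ S → singleton w₀ ⊆ S
singleton-⊆ {S = S} w₀∈S w h = subst (_∈ S) (sym (==W-sound h)) w₀∈S

_─_ : ∀ {n} → Sub n → Elem n → Sub n
(S ─ w₀) w = S w ∧ not (w ==W w₀)

─-intro : ∀ {n} (S : Sub n) {w₀ w} → w ∈ S → w ≢ w₀ → w ∈ (S ─ w₀)
─-intro S w∈S w≢w₀ = ∧-intro w∈S (cong not (==W-distinct w≢w₀))

─-⊆ : ∀ {n} (S : Sub n) {w₀} → (S ─ w₀) ⊆ S
─-⊆ S w h = proj₁ (∧-true {S w} h)

─-excludes : ∀ {n} (S : Sub n) {w₀} → ¬ (w₀ ∈ (S ─ w₀))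
─-excludes S {w₀} h
  with trans (sym (cong not (==W-refl w₀))) (proj₂ (∧-true {S w₀} h))
... | ()

sumFin-cong : ∀ {n} {f g : Fin n → ℕ} → (∀ i → f i ≡ g i) → sumFin f ≡ sumFin g
sumFin-cong {zero}  e = refl
sumFin-cong {suc n} e = cong₂ _+_ (e zero) (sumFin-cong (λ i → e (suc i)))

sumFin-hom : ∀ {n} (f g : Fin n → ℕ) → sumFin (λ v → f v + g v) ≡ sumFin f + sumFin g
sumFin-hom {zero}  f g = refl
sumFin-hom {suc n} f g =
  trans (cong ((f zero + g zero) +_) (sumFin-hom (λ i → f (suc i)) (λ i → g (suc i))))
        (interchange (f zero) (g zero) _ _)
  where
  interchange : ∀ a b c d → (a + b) + (c + d) ≡ (a + c) + (b + d)
  interchange = solve-∀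

sumFin-mono : ∀ {n} (f g : Fin n → ℕ) → (∀ v → f v ≤ g v) → sumFin f ≤ sumFin g
sumFin-mono {zero}  f g h = z≤n
sumFin-mono {suc n} f g h = +-mono-≤ (h zero) (sumFin-mono _ _ (λ v → h (suc v)))

sumFin-ones : ∀ n → sumFin {n} (λ _ → 1) ≡ n
sumFin-ones zero    = refl
sumFin-ones (suc n) = cong suc (sumFin-ones n)

sumFin-step : ∀ {n} (f g : Fin n → ℕ) v₀ → f v₀ ≡ suc (g v₀) → (∀ v → v ≢ v₀ → f v ≡ g v) →
  sumFin f ≡ suc (sumFin g)
sumFin-step f g zero e₀ e =
  cong₂ _+_ e₀ (sumFin-cong (λ i → e (suc i) (λ ())))
sumFin-step f g (suc v₀) e₀ e =
  trans (cong₂ _+_ (e zero (λ ()))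
                   (sumFin-step (λ i → f (suc i)) (λ i → g (suc i)) v₀ e₀
                                (λ v v≢ → e (suc v) (λ q → v≢ (suc-injective q)))))
        (+-suc (g zero) _)

sumFin-pos : ∀ {n} (f : Fin n → ℕ) {k} → sumFin f ≡ suc k → ∃ λ v → ∃ λ k′ → f v ≡ suc k′
sumFin-pos {suc n} f e with f zero in e₀
... | suc k′ = zero , k′ , e₀
... | zero with sumFin-pos (λ i → f (suc i)) e
...   | v , k′ , q = suc v , k′ , q

indicator : Bool → ℕ
indicator b = if b then 1 else 0

countAt : ∀ {n} → Sub n → Fin n → ℕ
countAt S v = sumL (λ l → indicator (S (v , l)))

card-cong : ∀ {n} {S S′ : Sub n} → (∀ w → S w ≡ S′ w) → card S ≡ card S′
card-cong e = sumFin-cong (λ v → cong₂ _+_ (cong indicator (e (v , φ)))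
                                   (cong₂ _+_ (cong indicator (e (v , χ))) (cong indicator (e (v , ψ)))))

card-transversal : ∀ {n} (T : Sub n) → Transversal T → card T ≡ n
card-transversal {n} T t = trans (sumFin-cong t) (sumFin-ones n)

card-nonempty : ∀ {n} (S : Sub n) {k} → card S ≡ suc k → ∃ λ w → w ∈ S
card-nonempty S e with sumFin-pos (countAt S) e
... | v , k′ , q with S (v , φ) in e₁ | S (v , χ) in e₂ | S (v , ψ) in e₃
...   | true  | _     | _     = (v , φ) , e₁
...   | false | true  | _     = (v , χ) , e₂
...   | false | false | true  = (v , ψ) , e₃
...   | false | false | false with q
...     | ()

card-remove : ∀ {n} (S : Sub n) w₀ → w₀ ∈ S → card S ≡ suc (card (S ─ w₀))
card-remove S (v₀ , l₀) w₀∈S =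
  sumFin-step (countAt S) (countAt (S ─ (v₀ , l₀))) v₀
    (sumL-step l₀ at-w₀ (λ l l≢ → away (λ q → l≢ (cong proj₂ q))))
    (λ v v≢ → cong₂ _+_ (away (λ q → v≢ (cong proj₁ q)))
                (cong₂ _+_ (away (λ q → v≢ (cong proj₁ q))) (away (λ q → v≢ (cong proj₁ q)))))
  where
  f = λ l → indicator (S (v₀ , l))
  g = λ l → indicator ((S ─ (v₀ , l₀)) (v₀ , l))
  sumL-step : ∀ l₀ → f l₀ ≡ suc (g l₀) → (∀ l → l ≢ l₀ → f l ≡ g l) → sumL f ≡ suc (sumL g)
  sumL-step φ e₀ e rewrite e₀ | e χ (λ ()) | e ψ (λ ()) = refl
  sumL-step χ e₀ e rewrite e₀ | e φ (λ ()) | e ψ (λ ()) = +-suc (g φ) _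
  sumL-step ψ e₀ e rewrite e₀ | e χ (λ ()) | e φ (λ ()) =
    trans (cong (g φ +_) (+-suc (g χ) (g ψ))) (+-suc (g φ) _)
  at-w₀ : indicator (S (v₀ , l₀)) ≡ suc (indicator ((S ─ (v₀ , l₀)) (v₀ , l₀)))
  at-w₀ rewrite w₀∈S | ==W-refl (v₀ , l₀) = refl
  away : ∀ {w} → w ≢ (v₀ , l₀) → indicator (S w) ≡ indicator ((S ─ (v₀ , l₀)) w)
  away {w} w≢ rewrite ==W-distinct w≢ = cong indicator (sym (∧-identityʳ (S w)))

card-empty : ∀ {n} (S : Sub n) → card S ≡ 0 → ∀ w → S w ≡ false
card-empty S e w with S w in h
... | false = refl
... | true with trans (sym e) (card-remove S w h)
...   | ()

card-mono : ∀ {n} (S S′ : Sub n) → S ⊆ S′ → card S ≤ card S′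
card-mono S S′ S⊆S′ =
  sumFin-mono _ _ (λ v → +-mono-≤ (at (v , φ)) (+-mono-≤ (at (v , χ)) (at (v , ψ))))
  where
  at : ∀ w → indicator (S w) ≤ indicator (S′ w)
  at w with S w in e
  ... | false = z≤n
  ... | true rewrite S⊆S′ w e = s≤s z≤n

card-split : ∀ {n} (S K : Sub n) →
  card S ≡ card (λ w → S w ∧ K w) + card (λ w → S w ∧ not (K w))
card-split S K =
  trans (sumFin-cong at-vertex) (sumFin-hom (countAt (λ w → S w ∧ K w)) (countAt (λ w → S w ∧ not (K w))))
  where
  at : ∀ w → indicator (S w) ≡ indicator (S w ∧ K w) + indicator (S w ∧ not (K w))
  at w with S w | K w
  ... | true  | true  = refl
  ... | true  | false = refl
  ... | false | _     = refl
  regroup : ∀ a b c d e f → (a + b) + ((c + d) + (e + f)) ≡ (a + (c + e)) + (b + (d + f))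
  regroup = solve-∀
  at-vertex : ∀ v → countAt S v ≡ countAt (λ w → S w ∧ K w) v + countAt (λ w → S w ∧ not (K w)) v
  at-vertex v rewrite at (v , φ) | at (v , χ) | at (v , ψ) =
    regroup (k (v , φ)) (k′ (v , φ)) (k (v , χ)) (k′ (v , χ)) (k (v , ψ)) (k′ (v , ψ))
    where
    k  = λ w → indicator (S w ∧ K w)
    k′ = λ w → indicator (S w ∧ not (K w))

card-injection : ∀ {n} (S S′ : Sub n) (f g : Elem n → Elem n) →
  (∀ w → w ∈ S → f w ∈ S′) → (∀ w → w ∈ S → g (f w) ≡ w) → card S ≤ card S′
card-injection S S′ f g f∈ gf = count (card S) S S′ refl f∈ gf
  where
  count : ∀ k (S S′ : Sub _) → card S ≡ k →
    (∀ w → w ∈ S → f w ∈ S′) → (∀ w → w ∈ S → g (f w) ≡ w) → k ≤ card S′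
  count zero    S S′ e f∈ gf = z≤n
  count (suc k) S S′ e f∈ gf with card-nonempty S e
  ... | w₀ , w₀∈S =
    subst (suc k ≤_) (sym (card-remove S′ (f w₀) (f∈ w₀ w₀∈S)))
      (s≤s (count k (S ─ w₀) (S′ ─ f w₀) (ℕ.suc-injective (trans (sym (card-remove S w₀ w₀∈S)) e))
                  f∈′ (λ w h → gf w (─-⊆ S w h))))
    where
    f∈′ : ∀ w → w ∈ (S ─ w₀) → f w ∈ (S′ ─ f w₀)
    f∈′ w h = ─-intro S′ (f∈ w (─-⊆ S w h)) f-distinct
      where
      f-distinct : f w ≢ f w₀
      f-distinct q = ─-excludes S (subst (_∈ (S ─ w₀))
        (trans (sym (gf w (─-⊆ S w h))) (trans (cong g q) (gf w₀ w₀∈S))) h)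

searchW : ∀ {n} {P : Elem n → Set} → (∀ w → Dec (P w)) → Dec (∃ P)
searchW {n} {P} P? with any? {P = λ v → ∃ λ l → P (v , l)} atVertex
  where
  atVertex : ∀ v → Dec (∃ λ l → P (v , l))
  atVertex v with P? (v , φ) | P? (v , χ) | P? (v , ψ)
  ... | yes p | _     | _     = yes (φ , p)
  ... | no _  | yes p | _     = yes (χ , p)
  ... | no _  | no _  | yes p = yes (ψ , p)
  ... | no a  | no b  | no c  = no λ { (φ , p) → a p ; (χ , p) → b p ; (ψ , p) → c p }
... | yes (v , l , p) = yes ((v , l) , p)
... | no ¬p           = no λ { ((v , l) , p) → ¬p (v , l , p) }

combo : ∀ {n} → Family n → Sub n → Vector n
combo F D i = sumW (λ w → D w ∧ F w i)

-- S is independent for F: no nonempty D ⊆ S has a vanishing combination.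
-- Independent A S (Defs) is Indep (col A) S by definition.
Indep : ∀ {n} → Family n → Sub n → Set
Indep F S = ∀ D → D ⊆ S → (∃[ w ] w ∈ D) → ¬ (∀ i → combo F D i ≡ false)

Indep-mono : ∀ {n} {F : Family n} {S S′ : Sub n} → Indep F S → S′ ⊆ S → Indep F S′
Indep-mono ind S′⊆S D D⊆S′ = ind D (λ w h → S′⊆S w (D⊆S′ w h))

combo-cong : ∀ {n} (F : Family n) {D D′ : Sub n} → (∀ w → D w ≡ D′ w) → ∀ i → combo F D i ≡ combo F D′ i
combo-cong F e i = sumW-cong (λ w → cong (_∧ F w i) (e w))

combo-hom : ∀ {n} (F : Family n) (D₁ D₂ : Sub n) i →
  combo F (λ w → D₁ w xor D₂ w) i ≡ combo F D₁ i xor combo F D₂ i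
combo-hom F D₁ D₂ i =
  trans (sumW-cong (λ w → ∧-distribʳ-xor (F w i) (D₁ w) (D₂ w)))
        (sumW-hom (λ w → D₁ w ∧ F w i) (λ w → D₂ w ∧ F w i))

combo-scale : ∀ {n} (F : Family n) b (D : Sub n) i → combo F (λ w → b ∧ D w) i ≡ b ∧ combo F D i
combo-scale F b D i =
  trans (sumW-cong (λ w → ∧-assoc b (D w) (F w i))) (sumW-scale b (λ w → D w ∧ F w i))

combo-single : ∀ {n} (F : Family n) p i → combo F (singleton p) i ≡ F p i
combo-single F p i =
  trans (sumW-single p (λ w → (w ==W p) ∧ F w i) (λ w w≢p → cong (_∧ F w i) (==W-distinct w≢p)))
        (cong (_∧ F p i) (==W-refl p))

combo-shift : ∀ {n} (F : Family n) (c : Elem n → Bool) (y : Vector n) (D : Sub n) i →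
  combo (λ w j → F w j xor (c w ∧ y j)) D i ≡ combo F D i xor (sumW (λ w → D w ∧ c w) ∧ y i)
combo-shift F c y D i =
  trans (sumW-cong (λ w → distribute (D w) (F w i) (c w) (y i)))
  (trans (sumW-hom (λ w → D w ∧ F w i) (λ w → (D w ∧ c w) ∧ y i))
         (cong (combo F D i xor_)
           (trans (sumW-cong (λ w → ∧-comm (D w ∧ c w) (y i)))
           (trans (sumW-scale (y i) (λ w → D w ∧ c w)) (∧-comm (y i) _)))))
  where
  distribute : ∀ d f c y → d ∧ (f xor (c ∧ y)) ≡ (d ∧ f) xor ((d ∧ c) ∧ y)
  distribute false f c y = refl
  distribute true  f c y = refl

_·_ : ∀ {n} → Vector n → Vector n → Bool
u · x = xorFin (λ i → u i ∧ x i)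

·-cong : ∀ {n} (u : Vector n) {x y : Vector n} → (∀ i → x i ≡ y i) → u · x ≡ u · y
·-cong u e = xorFin-cong (λ i → cong (u i ∧_) (e i))

·-hom : ∀ {n} (u x y : Vector n) → u · (λ i → x i xor y i) ≡ (u · x) xor (u · y)
·-hom u x y = trans (xorFin-cong (λ i → ∧-distribˡ-xor (u i) (x i) (y i)))
                    (xorFin-hom (λ i → u i ∧ x i) (λ i → u i ∧ y i))

∧-leftComm : ∀ a b c → a ∧ (b ∧ c) ≡ b ∧ (a ∧ c)
∧-leftComm false b c = sym (∧-zeroʳ b)
∧-leftComm true  b c = refl

·-scale : ∀ {n} (u x : Vector n) b → u · (λ i → b ∧ x i) ≡ b ∧ (u · x)
·-scale u x b = trans (xorFin-cong (λ i → ∧-leftComm (u i) b (x i))) (xorFin-scale b (λ i → u i ∧ x i))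

·-combo : ∀ {n} (u : Vector n) (F : Family n) (D : Sub n) → u · combo F D ≡ sumW (λ w → D w ∧ (u · F w))
·-combo u F D =
  trans (xorFin-cong (λ i → sym (sumW-scale (u i) (λ w → D w ∧ F w i))))
  (trans (sym (sumW-xorFin (λ w i → u i ∧ (D w ∧ F w i))))
         (sumW-cong (λ w → trans (xorFin-cong (λ i → ∧-leftComm (u i) (D w) (F w i)))
                                 (xorFin-scale (D w) (λ i → u i ∧ F w i)))))

unit : ∀ {n} → Fin n → Vector n
unit c i = i == c

unit-· : ∀ {n} (c : Fin n) (x : Vector n) → unit c · x ≡ x c
unit-· c x =
  trans (xorFin-single c _ (λ v v≢c → cong (_∧ x v) (==-distinct v≢c))) (cong (_∧ x c) (==-refl c))

add-unit : ∀ {n} → Vector n → Fin n → Bool → Vector n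
add-unit u c a i = u i xor (unit c i ∧ a)

add-unit-· : ∀ {n} (u : Vector n) c a (x : Vector n) → add-unit u c a · x ≡ (u · x) xor (a ∧ x c)
add-unit-· u c a x =
  trans (xorFin-cong (λ i → ∧-distribʳ-xor (x i) (u i) _))
  (trans (xorFin-hom (λ i → u i ∧ x i) (λ i → (unit c i ∧ a) ∧ x i))
         (cong ((u · x) xor_)
           (trans (xorFin-cong (λ i → ∧-assoc (unit c i) a (x i))) (unit-· c (λ i → a ∧ x i)))))

InSpan : ∀ {n} → Family n → Sub n → Vector n → Set
InSpan F B t = ∃ λ D → D ⊆ B × (∀ i → combo F D i ≡ t i)

Separates : ∀ {n} → Family n → Sub n → Vector n → Vector n → Set
Separates F B t u = (∀ w → w ∈ B → u · F w ≡ false) × u · t ≡ true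

span-mono : ∀ {n} {F : Family n} {B B′ t} → B ⊆ B′ → InSpan F B t → InSpan F B′ t
span-mono B⊆B′ (D , D⊆B , eq) = D , (λ w h → B⊆B′ w (D⊆B w h)) , eq

span-member : ∀ {n} (F : Family n) (B : Sub n) w → w ∈ B → InSpan F B (F w)
span-member F B w w∈B =
  singleton w , singleton-⊆ w∈B , combo-single F w

span-annihilated : ∀ {n} {F : Family n} {B t} (u : Vector n) → InSpan F B t →
  (∀ w → w ∈ B → u · F w ≡ false) → u · t ≡ false
span-annihilated {F = F} u (D , D⊆B , eq) u⊥B =
  trans (sym (·-cong u eq)) (trans (·-combo u F D) (sumW-zero _ term))
  where
  term : ∀ w → D w ∧ (u · F w) ≡ false
  term w with D w in e
  ... | false = refl
  ... | true  = u⊥B w (D⊆B w e)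

-- Gaussian elimination at coordinate c with pivot vector y (where y c = true):
-- clear c y x = x + x_c·y has vanishing c-th coordinate.
clear : ∀ {n} → Fin n → Vector n → Vector n → Vector n
clear c y x j = x j xor (x c ∧ y j)

clear-pivot : ∀ {n} {c : Fin n} {y : Vector n} → y c ≡ true → ∀ j → clear c y y j ≡ false
clear-pivot {y = y} yc j rewrite yc = xor-same (y j)

·-zero : ∀ {n} (u x : Vector n) → (∀ j → x j ≡ false) → u · x ≡ false
·-zero u x x≡0 = xorFin-zero _ (λ j → trans (cong (u j ∧_) (x≡0 j)) (∧-zeroʳ (u j)))

·-clear : ∀ {n} (u y x : Vector n) c → add-unit u c (u · y) · x ≡ u · clear c y x
·-clear u y x c =
  trans (add-unit-· u c (u · y) x)
        (sym (trans (·-hom u x (λ j → x c ∧ y j))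
                    (cong ((u · x) xor_) (trans (·-scale u y (x c)) (∧-comm (x c) (u · y))))))

shift-transfer : ∀ x a b q τ → x xor (a ∧ q) ≡ τ xor (b ∧ q) → x xor ((a xor b) ∧ q) ≡ τ
shift-transfer x a b q τ h = begin
  x xor ((a xor b) ∧ q)         ≡⟨ cong (x xor_) (∧-distribʳ-xor q a b) ⟩
  x xor ((a ∧ q) xor (b ∧ q))   ≡⟨ sym (xor-assoc x _ _) ⟩
  (x xor (a ∧ q)) xor (b ∧ q)   ≡⟨ cong (_xor (b ∧ q)) h ⟩
  (τ xor (b ∧ q)) xor (b ∧ q)   ≡⟨ xor-assoc τ _ _ ⟩
  τ xor ((b ∧ q) xor (b ∧ q))   ≡⟨ cong (τ xor_) (xor-same (b ∧ q)) ⟩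
  τ xor false                   ≡⟨ xor-identityʳ τ ⟩
  τ                             ∎
  where open ≡-Reasoning

SolvesOn : ∀ {n} → List (Fin n) → Family n → Sub n → Vector n → Set
SolvesOn cs F B t = ∃ λ D → D ⊆ B × All (λ i → combo F D i ≡ t i) cs

-- One elimination step with pivot p ∈ B at coordinate c transports solutions
-- and separating functionals of the reduced system back to the original one.
module Pivot {n} (F : Family n) (B : Sub n) (t : Vector n) (c : Fin n)
             (p : Elem n) (p∈B : p ∈ B) (pivot : F p c ≡ true) where

  F′ : Family n
  F′ w = clear c (F p) (F w)

  t′ : Vector n
  t′ = clear c (F p) t

  lift-solution : ∀ {cs} → SolvesOn cs F′ (B ─ p) t′ → SolvesOn (c ∷ cs) F B t
  lift-solution (D′ , D′⊆ , eqs) = D , D⊆B , at-c ∷ All.map at-i eqs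
    where
    s = combo F D′ c xor t c
    D : Sub n
    D w = D′ w xor (s ∧ singleton p w)
    D⊆B : D ⊆ B
    D⊆B w h with D′ w in e
    ... | true  = ─-⊆ B w (D′⊆ w e)
    ... | false = subst (_∈ B) (sym (==W-sound (proj₂ (∧-true {s} h)))) p∈B
    combo-D : ∀ i → combo F D i ≡ combo F D′ i xor (s ∧ F p i)
    combo-D i = trans (combo-hom F D′ (λ w → s ∧ singleton p w) i)
                      (cong (combo F D′ i xor_) (trans (combo-scale F s (singleton p) i)
                                                       (cong (s ∧_) (combo-single F p i))))
    at-c : combo F D c ≡ t c
    at-c = trans (combo-D c) (trans (cong (λ q → combo F D′ c xor (s ∧ q)) pivot) (settle (combo F D′ c) (t c)))
      where
      settle : ∀ x τ → x xor ((x xor τ) ∧ true) ≡ τ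
      settle x τ = trans (cong (x xor_) (∧-identityʳ (x xor τ)))
                         (trans (sym (xor-assoc x x τ)) (cong (_xor τ) (xor-same x)))
    at-i : ∀ {i} → combo F′ D′ i ≡ t′ i → combo F D i ≡ t i
    at-i {i} h = trans (combo-D i) (shift-transfer (combo F D′ i) (combo F D′ c) (t c) (F p i) (t i)
                   (trans (sym (combo-shift F (λ w → F w c) (F p) D′ i)) h))

  lift-separator : ∃ (Separates F′ (B ─ p) t′) → ∃ (Separates F B t)
  lift-separator (u′ , u′⊥ , u′t) = add-unit u′ c (u′ · F p) , u⊥ , trans (·-clear u′ (F p) t c) u′t
    where
    u⊥ : ∀ w → w ∈ B → add-unit u′ c (u′ · F p) · F w ≡ false
    u⊥ w w∈B with w ≟W p
    ... | yes refl = trans (·-clear u′ (F p) (F p) c) (·-zero u′ _ (clear-pivot {c = c} {y = F w} pivot))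
    ... | no w≢p   = trans (·-clear u′ (F p) (F w) c) (u′⊥ w (─-intro B w∈B w≢p))

fredholm : ∀ {n} (cs : List (Fin n)) (F : Family n) (B : Sub n) (t : Vector n) →
  SolvesOn cs F B t ⊎ ∃ (Separates F B t)
fredholm []       F B t = inj₁ ((λ _ → false) , (λ w ()) , [])
fredholm (c ∷ cs) F B t with searchW (λ w → (B w Bool.≟ true) ×-dec (F w c Bool.≟ true))
... | yes (p , p∈B , pivot) with fredholm cs (Pivot.F′ F B t c p p∈B pivot) (B ─ p) (Pivot.t′ F B t c p p∈B pivot)
...   | inj₁ sol = inj₁ (Pivot.lift-solution F B t c p p∈B pivot sol)
...   | inj₂ sep = inj₂ (Pivot.lift-separator F B t c p p∈B pivot sep)
fredholm (c ∷ cs) F B t | no no-pivot with t c in tc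
...   | true  = inj₂ (unit c , unit⊥ , trans (unit-· c t) tc)
  where
  unit⊥ : ∀ w → w ∈ B → unit c · F w ≡ false
  unit⊥ w w∈B with F w c in e
  ... | false = trans (unit-· c (F w)) e
  ... | true  = ⊥-elim (no-pivot (w , w∈B , e))
...   | false with fredholm cs F B t
...     | inj₂ sep = inj₂ sep
...     | inj₁ (D , D⊆B , eqs) = inj₁ (D , D⊆B , at-c ∷ eqs)
  where
  at-c : combo F D c ≡ t c
  at-c = trans (sumW-zero _ term) (sym tc)
    where
    term : ∀ w → D w ∧ F w c ≡ false
    term w with D w in e
    ... | false = refl
    ... | true with F w c in e′
    ...   | false = refl
    ...   | true  = ⊥-elim (no-pivot (w , D⊆B w e , e′))

span-decide : ∀ {n} (F : Family n) (B : Sub n) (t : Vector n) → InSpan F B t ⊎ ∃ (Separates F B t)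
span-decide {n} F B t with fredholm (allFin n) F B t
... | inj₁ (D , D⊆B , eqs) = inj₁ (D , D⊆B , λ i → All.lookup eqs (∈-allFin i))
... | inj₂ sep             = inj₂ sep

insert : ∀ {n} → Elem n → Sub n → Sub n
insert s B w = B w ∨ singleton s w

insert-⊇ : ∀ {n} (s : Elem n) (B : Sub n) → B ⊆ insert s B
insert-⊇ s B w = ∨-introˡ

insert-new : ∀ {n} (s : Elem n) (B : Sub n) → s ∈ insert s B
insert-new s B = ∨-introʳ {B s} (==W-refl s)

insert-⊆ : ∀ {n} {s : Elem n} {B T : Sub n} → B ⊆ T → s ∈ T → insert s B ⊆ T
insert-⊆ {s = s} {B} {T} B⊆T s∈T w h with ∨-true {B w} h
... | inj₁ w∈B  = B⊆T w w∈B
... | inj₂ w==s = singleton-⊆ s∈T w w==s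

extend-indep : ∀ {n} (F : Family n) (B : Sub n) s (u : Vector n) → Indep F B →
  (∀ w → w ∈ B → u · F w ≡ false) → u · F s ≡ true → Indep F (insert s B)
extend-indep {n} F B s u ind u⊥B us D D⊆ nonempty vanishes = ind D D⊆B nonempty vanishes
  where
  -- u kills the combination, which reduces to the single term at s
  sum-zero : sumW (λ w → D w ∧ (u · F w)) ≡ false
  sum-zero = trans (sym (·-combo u F D)) (·-zero u (combo F D) vanishes)
  s∉D : D s ≡ false
  s∉D with D s in e
  ... | false = refl
  ... | true  = ⊥-elim (false≢true (trans (sym sum-zero) (trans (sumW-single s _ other) (trans (cong (_∧ (u · F s)) e) us))))
    where
    other : ∀ w → w ≢ s → D w ∧ (u · F w) ≡ false
    other w w≢s with D w in e′
    ... | false = refl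
    ... | true with ∨-true {B w} (D⊆ w e′)
    ...   | inj₁ w∈B  = u⊥B w w∈B
    ...   | inj₂ w==s = ⊥-elim (w≢s (==W-sound w==s))
  D⊆B : D ⊆ B
  D⊆B w h with ∨-true {B w} (D⊆ w h)
  ... | inj₁ w∈B  = w∈B
  ... | inj₂ w==s = ⊥-elim (false≢true (trans (sym s∉D) (subst (_∈ D) (==W-sound w==s) h)))

greedy-basis : ∀ {n} (F : Family n) (S : Sub n) →
  ∃ λ B → B ⊆ S × Indep F B × (∀ w → w ∈ S → InSpan F B (F w))
greedy-basis F S = build (card S) S refl
  where
  build : ∀ k (S : Sub _) → card S ≡ k → ∃ λ B → B ⊆ S × Indep F B × (∀ w → w ∈ S → InSpan F B (F w))
  build zero S e =
    (λ _ → false) , (λ w ()) , (λ D D⊆ (w , w∈D) _ → false≢true (D⊆ w w∈D)) ,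
    λ w w∈S → ⊥-elim (false≢true (trans (sym (card-empty S e w)) w∈S))
  build (suc k) S e with card-nonempty S e
  ... | s , s∈S with build k (S ─ s) (ℕ.suc-injective (trans (sym (card-remove S s s∈S)) e))
  ...   | B , B⊆ , ind , spans with span-decide F B (F s)
  ...     | inj₁ s-spanned = B , (λ w h → ─-⊆ S w (B⊆ w h)) , ind , spans′
    where
    spans′ : ∀ w → w ∈ S → InSpan F B (F w)
    spans′ w w∈S with w ≟W s
    ... | yes refl = s-spanned
    ... | no w≢s   = spans w (─-intro S w∈S w≢s)
  ...     | inj₂ (u , u⊥B , us) =
    insert s B , insert-⊆ (λ w h → ─-⊆ S w (B⊆ w h)) s∈S , extend-indep F B s u ind u⊥B us , spans′
    where
    spans′ : ∀ w → w ∈ S → InSpan F (insert s B) (F w)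
    spans′ w w∈S with w ≟W s
    ... | yes refl = span-member F (insert s B) w (insert-new w B)
    ... | no w≢s   = span-mono {F = F} (insert-⊇ s B) (spans w (─-intro S w∈S w≢s))

spanning-basis : ∀ {n} (A : Adj n) T B → B ⊆ T → Independent A B →
  (∀ w → w ∈ T → InSpan (col A) B (col A w)) → IsBasis A T B
spanning-basis {n} A T B B⊆T ind spans = B⊆T , ind , maximal
  where
  maximal : ∀ J → B ⊆ J → J ⊆ T → Independent A J → J ⊆ B
  maximal J B⊆J J⊆T indJ w w∈J with B w in w∈B
  ... | true  = refl
  ... | false with spans w (J⊆T w w∈J)
  ...   | D , D⊆B , eq = ⊥-elim (indJ D′ D′⊆J (w , w∈D′) vanishes)
    where
    -- D + {w} is a dependency inside J
    w∉D : D w ≡ false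
    w∉D with D w in e
    ... | false = refl
    ... | true  = ⊥-elim (false≢true (trans (sym w∈B) (D⊆B w e)))
    D′ : Sub n
    D′ u = D u xor singleton w u
    D′⊆J : D′ ⊆ J
    D′⊆J u h with D u in e
    ... | true  = B⊆J u (D⊆B u e)
    ... | false = singleton-⊆ w∈J u h
    w∈D′ : D′ w ≡ true
    w∈D′ rewrite w∉D | ==W-refl w = refl
    vanishes : ∀ i → combo (col A) D′ i ≡ false
    vanishes i = trans (combo-hom (col A) D (singleton w) i)
                       (trans (cong₂ _xor_ (eq i) (combo-single (col A) w i)) (xor-same (col A w i)))

basis-spans : ∀ {n} (A : Adj n) T B → IsBasis A T B → ∀ w → w ∈ T → InSpan (col A) B (col A w)
basis-spans A T B (B⊆T , ind , maximal) w w∈T with span-decide (col A) B (col A w)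
... | inj₁ spanned       = spanned
... | inj₂ (u , u⊥B , uw) =
  span-member (col A) B w
    (maximal (insert w B) (insert-⊇ w B) (insert-⊆ B⊆T w∈T) (extend-indep (col A) B w u ind u⊥B uw)
             w (insert-new w B))

Represents : ∀ {n} → Family n → Sub n → Family n → Sub n → (Elem n → Sub n) → Set
Represents FB B FI I R = ∀ w → w ∈ I → R w ⊆ B × (∀ i → combo FB (R w) i ≡ FI w i)

module Exchange {n} (FI FB : Family n) (I B : Sub n) (R : Elem n → Sub n)
                (ind : Indep FI I) (rep : Represents FB B FI I R)
                (b p : Elem n) (p∈I : p ∈ I) (p-uses-b : R p b ≡ true) where

  FI′ : Family n
  FI′ w i = FI w i xor (R w b ∧ FI p i)

  R′ : Elem n → Sub n
  R′ w u = R w u xor (R w b ∧ R p u)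

  exchanged-indep : Indep FI′ (I ─ p)
  exchanged-indep D D⊆ (w₀ , w₀∈D) vanishes = ind D⁺ D⁺⊆I (w₀ , w₀∈D⁺) vanishes⁺
    where
    s = sumW (λ w → D w ∧ R w b)
    -- a dependency of FI′ on I ─ p gives the dependency D + s·{p} of FI on I
    D⁺ : Sub n
    D⁺ u = D u xor (s ∧ singleton p u)
    D⁺⊆I : D⁺ ⊆ I
    D⁺⊆I u h with D u in e
    ... | true  = ─-⊆ I u (D⊆ u e)
    ... | false = singleton-⊆ p∈I u (proj₂ (∧-true {s} h))
    w₀∈D⁺ : D⁺ w₀ ≡ true
    w₀∈D⁺ with compareW w₀ p
    ... | inj₁ refl  = ⊥-elim (─-excludes I (D⊆ w₀ w₀∈D))
    ... | inj₂ w₀≢p = trans (cong₂ (λ d q → d xor (s ∧ q)) w₀∈D (==W-distinct w₀≢p))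
                             (cong (true xor_) (∧-zeroʳ s))
    vanishes⁺ : ∀ i → combo FI D⁺ i ≡ false
    vanishes⁺ i =
      trans (combo-hom FI D (λ u → s ∧ singleton p u) i)
      (trans (cong (combo FI D i xor_) (trans (combo-scale FI s (singleton p) i) (cong (s ∧_) (combo-single FI p i))))
      (trans (sym (combo-shift FI (λ w → R w b) (FI p) D i)) (vanishes i)))

  exchanged-represents : Represents FB (B ─ b) FI′ (I ─ p) R′
  exchanged-represents w w∈ = R′⊆ , represents
    where
    w∈I = ─-⊆ I w w∈
    R′⊆ : R′ w ⊆ (B ─ b)
    R′⊆ u h with compareW u b
    ... | inj₁ refl = ⊥-elim (false≢true (trans (sym b-cancels) h))
      where
      b-cancels : R w u xor (R w u ∧ R p u) ≡ false
      b-cancels rewrite p-uses-b | ∧-identityʳ (R w u) = xor-same (R w u)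
    ... | inj₂ u≢b with R w u in e
    ...   | true  = ─-intro B (proj₁ (rep w w∈I) u e) u≢b
    ...   | false = ─-intro B (proj₁ (rep p p∈I) u (proj₂ (∧-true {R w b} h))) u≢b
    represents : ∀ i → combo FB (R′ w) i ≡ FI′ w i
    represents i =
      trans (combo-hom FB (R w) (λ u → R w b ∧ R p u) i)
            (cong₂ _xor_ (proj₂ (rep w w∈I) i)
                         (trans (combo-scale FB (R w b) (R p) i) (cong (R w b ∧_) (proj₂ (rep p p∈I) i))))

steinitz-core : ∀ {n} k (FI FB : Family n) (I B : Sub n) (R : Elem n → Sub n) →
  card B ≡ k → Indep FI I → Represents FB B FI I R → card I ≤ k
steinitz-core zero FI FB I B R |B|≡0 ind rep with card I in cI
... | zero  = z≤n
... | suc _ with card-nonempty I cI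
...   | w , w∈I = ⊥-elim (ind (singleton w) (singleton-⊆ w∈I) (w , ==W-refl w) vanishes)
  where
  -- B is empty, so FI w is the empty combination
  vanishes : ∀ i → combo FI (singleton w) i ≡ false
  vanishes i = trans (combo-single FI w i) (trans (sym (proj₂ (rep w w∈I) i)) (sumW-zero _ term))
    where
    term : ∀ u → R w u ∧ FB u i ≡ false
    term u with R w u in e
    ... | false = refl
    ... | true  = ⊥-elim (false≢true (trans (sym (card-empty B |B|≡0 u)) (proj₁ (rep w w∈I) u e)))
steinitz-core (suc k) FI FB I B R |B|≡1+k ind rep with card-nonempty B |B|≡1+k
... | b , b∈B with searchW (λ w → (I w Bool.≟ true) ×-dec (R w b Bool.≟ true))
...   | no unused =
  m≤n⇒m≤1+n (steinitz-core k FI FB I (B ─ b) R |B─b| ind rep′)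
  where
  |B─b| = ℕ.suc-injective (trans (sym (card-remove B b b∈B)) |B|≡1+k)
  rep′ : Represents FB (B ─ b) FI I R
  rep′ w w∈I = R⊆ , proj₂ (rep w w∈I)
    where
    R⊆ : R w ⊆ (B ─ b)
    R⊆ u h with compareW u b
    ... | inj₁ refl = ⊥-elim (unused (w , w∈I , h))
    ... | inj₂ u≢b  = ─-intro B (proj₁ (rep w w∈I) u h) u≢b
...   | yes (p , p∈I , p-uses-b) =
  subst (_≤ suc k) (sym (card-remove I p p∈I))
    (s≤s (steinitz-core k FI′ FB (I ─ p) (B ─ b) R′ |B─b| exchanged-indep exchanged-represents))
  where
  |B─b| = ℕ.suc-injective (trans (sym (card-remove B b b∈B)) |B|≡1+k)
  open Exchange FI FB I B R ind rep b p p∈I p-uses-b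

-- choice of one representation for each element of I
private
  whenTrue : ∀ {n} (b : Bool) → (b ≡ true → Sub n) → Sub n
  whenTrue true  k = k refl
  whenTrue false k = λ _ → false

  whenTrue-true : ∀ {n} b (e : b ≡ true) (k : b ≡ true → Sub n) → whenTrue b k ≡ k e
  whenTrue-true true refl k = refl

steinitz : ∀ {n} (FI FB : Family n) (I B : Sub n) → Indep FI I →
  (∀ w → w ∈ I → InSpan FB B (FI w)) → card I ≤ card B
steinitz {n} FI FB I B ind spans = steinitz-core (card B) FI FB I B R refl ind rep
  where
  R : Elem n → Sub n
  R w = whenTrue (I w) (λ e → proj₁ (spans w e))
  rep : Represents FB B FI I R
  rep w w∈I rewrite whenTrue-true (I w) w∈I (λ e → proj₁ (spans w e)) = proj₂ (spans w w∈I)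

data LabelSwap : Set where
  keep swapφχ swapφψ swapχψ : LabelSwap

swap : LabelSwap → Label → Label
swap keep   l = l
swap swapφχ φ = χ
swap swapφχ χ = φ
swap swapφχ ψ = ψ
swap swapφψ φ = ψ
swap swapφψ χ = χ
swap swapφψ ψ = φ
swap swapχψ φ = φ
swap swapχψ χ = ψ
swap swapχψ ψ = χ

swap-involutive : ∀ s l → swap s (swap s l) ≡ l
swap-involutive keep   l = refl
swap-involutive swapφχ φ = refl
swap-involutive swapφχ χ = refl
swap-involutive swapφχ ψ = refl
swap-involutive swapφψ φ = refl
swap-involutive swapφψ χ = refl
swap-involutive swapφψ ψ = refl
swap-involutive swapχψ φ = refl
swap-involutive swapχψ χ = refl
swap-involutive swapχψ ψ = refl

module LabelSum {A : Set} (_∙_ : A → A → A)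
                (assoc : ∀ x y z → (x ∙ y) ∙ z ≡ x ∙ (y ∙ z))
                (comm : ∀ x y → x ∙ y ≡ y ∙ x) where

  sum3 : (Label → A) → A
  sum3 f = f φ ∙ (f χ ∙ f ψ)

  sum3-swap : ∀ s (f : Label → A) → sum3 (λ l → f (swap s l)) ≡ sum3 f
  sum3-swap keep   f = refl
  sum3-swap swapφχ f =
    trans (sym (assoc (f χ) (f φ) (f ψ))) (trans (cong (_∙ f ψ) (comm (f χ) (f φ))) (assoc (f φ) (f χ) (f ψ)))
  sum3-swap swapφψ f =
    trans (sym (assoc (f ψ) (f χ) (f φ))) (trans (comm _ (f φ)) (cong (f φ ∙_) (comm (f ψ) (f χ))))
  sum3-swap swapχψ f = cong (f φ ∙_) (comm (f ψ) (f χ))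

open LabelSum _xor_ xor-assoc xor-comm using () renaming (sum3-swap to xorL-swap)
open LabelSum _+_ +-assoc +-comm using () renaming (sum3-swap to sumL-swap)

Relabelling : ℕ → Set
Relabelling n = Fin n → LabelSwap

relabel : ∀ {n} → Relabelling n → Elem n → Elem n
relabel π (v , l) = v , swap (π v) l

relabel-involutive : ∀ {n} (π : Relabelling n) w → relabel π (relabel π w) ≡ w
relabel-involutive π (v , l) = cong (v ,_) (swap-involutive (π v) l)

-- the preimage of S under a relabelling (which is also its image)
_∘ʳ_ : ∀ {n} → Sub n → Relabelling n → Sub n
(S ∘ʳ π) w = S (relabel π w)

∘ʳ-∘ʳ⁻ : ∀ {n} (π : Relabelling n) (S : Sub n) → ((S ∘ʳ π) ∘ʳ π) ⊆ S
∘ʳ-∘ʳ⁻ π S w = subst (_∈ S) (relabel-involutive π w)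

∘ʳ-∘ʳ⁺ : ∀ {n} (π : Relabelling n) (S : Sub n) → S ⊆ ((S ∘ʳ π) ∘ʳ π)
∘ʳ-∘ʳ⁺ π S w = subst (_∈ S) (sym (relabel-involutive π w))

∘ʳ-mono : ∀ {n} (π : Relabelling n) {S T : Sub n} → S ⊆ T → (S ∘ʳ π) ⊆ (T ∘ʳ π)
∘ʳ-mono π S⊆T w = S⊆T (relabel π w)

sumW-relabel : ∀ {n} (π : Relabelling n) (f : Elem n → Bool) → sumW (λ w → f (relabel π w)) ≡ sumW f
sumW-relabel π f = xorFin-cong (λ v → xorL-swap (π v) (λ l → f (v , l)))

card-relabel : ∀ {n} (π : Relabelling n) (S : Sub n) → card (S ∘ʳ π) ≡ card S
card-relabel π S = sumFin-cong (λ v → sumL-swap (π v) (λ l → indicator (S (v , l))))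

transversal-relabel : ∀ {n} (π : Relabelling n) {T : Sub n} → Transversal T → Transversal (T ∘ʳ π)
transversal-relabel π {T} t v = trans (sumL-swap (π v) (λ l → indicator (T (v , l)))) (t v)

disjTransversals-relabel : ∀ {n} (π : Relabelling n) {T₁ T₂ : Sub n} →
  DisjTransversals T₁ T₂ → DisjTransversals (T₁ ∘ʳ π) (T₂ ∘ʳ π)
disjTransversals-relabel π {T₁} {T₂} (t₁ , t₂ , disj) =
  transversal-relabel π {T₁} t₁ , transversal-relabel π {T₂} t₂ , λ w → disj (relabel π w)

clear-cong : ∀ {n} (c : Fin n) (N : Vector n) {x y : Vector n} → (∀ i → x i ≡ y i) →
  ∀ i → clear c N x i ≡ clear c N y i
clear-cong c N e i = cong₂ (λ a b → a xor (b ∧ N i)) (e i) (e c)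

clear-involutive : ∀ {n} {c : Fin n} {N : Vector n} → N c ≡ false → ∀ x i → clear c N (clear c N x) i ≡ x i
clear-involutive {c = c} {N} Nc x i rewrite Nc | ∧-zeroʳ (x c) | xor-identityʳ (x c) =
  trans (xor-assoc (x i) _ _) (trans (cong (x i xor_) (xor-same (x c ∧ N i))) (xor-identityʳ (x i)))

record Similar {n} (F F′ : Family n) : Set where
  field
    π       : Relabelling n
    c       : Fin n
    N       : Vector n
    N-c     : N c ≡ false
    columns : ∀ w i → F′ (relabel π w) i ≡ clear c N (F w) i

Similar-sym : ∀ {n} {F F′ : Family n} → Similar F F′ → Similar F′ F
Similar-sym {F = F} {F′} R = record { π = π ; c = c ; N = N ; N-c = N-c ; columns = columns′ }
  where
  open Similar R
  columns′ : ∀ w i → F (relabel π w) i ≡ clear c N (F′ w) i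
  columns′ w i =
    trans (sym (clear-involutive N-c (F (relabel π w)) i))
          (clear-cong c N (λ j → sym (trans (cong (λ u → F′ u j) (sym (relabel-involutive π w)))
                                            (columns (relabel π w) j))) i)

module _ {n} {F F′ : Family n} (R : Similar F F′) where
  open Similar R

  combo-similar : ∀ D i → combo F′ D i ≡ clear c N (combo F (D ∘ʳ π)) i
  combo-similar D i =
    trans (sym (sumW-relabel π (λ w → D w ∧ F′ w i)))
    (trans (sumW-cong (λ w → cong (D (relabel π w) ∧_) (columns w i)))
           (combo-shift F (λ w → F w c) N (D ∘ʳ π) i))

  indep-similar : ∀ I → Indep F I → Indep F′ (I ∘ʳ π)
  indep-similar I ind D D⊆ (w , w∈D) vanishes =
    ind (D ∘ʳ π) (λ u h → ∘ʳ-∘ʳ⁻ π I u (D⊆ (relabel π u) h)) (relabel π w , ∘ʳ-∘ʳ⁺ π D w w∈D) vanishes′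
    where
    vanishes′ : ∀ i → combo F (D ∘ʳ π) i ≡ false
    vanishes′ i =
      trans (sym (clear-involutive N-c (combo F (D ∘ʳ π)) i))
             (clear-cong c N (λ j → trans (sym (combo-similar D j)) (vanishes j)) i)

indep-similar⁻ : ∀ {n} {F F′ : Family n} (R : Similar F F′) I → Indep F′ (I ∘ʳ Similar.π R) → Indep F I
indep-similar⁻ {F = F} R I ind =
  Indep-mono {F = F} (indep-similar (Similar-sym R) (I ∘ʳ Similar.π R) ind) (∘ʳ-∘ʳ⁺ (Similar.π R) I)

PairProperty : Set₁
PairProperty = ∀ {n} → Adj n → Sub n → Sub n → Set

PairCondition : PairProperty → ∀ {n} → Adj n → Set
PairCondition X G = ∃[ T₁ ] ∃[ T₂ ] (DisjTransversals T₁ T₂ × X G T₁ T₂)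

RanksSumTo : PairProperty
RanksSumTo {n} A T₁ T₂ = ∃[ r₁ ] ∃[ r₂ ] (IsRank A T₁ r₁ × IsRank A T₂ r₂ × r₁ + r₂ ≡ n)

Invariant : PairProperty → Set
Invariant X = ∀ {n} {A A′ : Adj n} (R : Similar (col A) (col A′)) {T₁ T₂ : Sub n} →
  X A T₁ T₂ → X A′ (T₁ ∘ʳ Similar.π R) (T₂ ∘ʳ Similar.π R)

PairCondition-transport : ∀ {X : PairProperty} → Invariant X → ∀ {n} {A A′ : Adj n} →
  Similar (col A) (col A′) → PairCondition X A → PairCondition X A′
PairCondition-transport X-inv R (T₁ , T₂ , dt , x) =
  T₁ ∘ʳ π , T₂ ∘ʳ π , disjTransversals-relabel π dt , X-inv R x
  where open Similar R using (π)

_≐_ : ∀ {n} → Sub n → Sub n → Set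
S ≐ T = ∀ w → S w ≡ T w

≐-⊆ : ∀ {n} {S T : Sub n} → S ≐ T → S ⊆ T
≐-⊆ e w h = trans (sym (e w)) h

≐-sym : ∀ {n} {S T : Sub n} → S ≐ T → T ≐ S
≐-sym e w = sym (e w)

basis-≐ : ∀ {n} {A : Adj n} {T T′ B} → T ≐ T′ → IsBasis A T B → IsBasis A T′ B
basis-≐ e (B⊆T , ind , maximal) =
  (λ w h → ≐-⊆ e w (B⊆T w h)) , ind , λ J B⊆J J⊆T′ → maximal J B⊆J (λ w h → ≐-⊆ (≐-sym e) w (J⊆T′ w h))

dualIndep-≐ : ∀ {n} {A : Adj n} {T T′ J J′} → T ≐ T′ → J ≐ J′ →
  DualIndependent A T J → DualIndependent A T′ J′
dualIndep-≐ eT eJ (J⊆T , B , basis , disj) =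
  (λ w h → ≐-⊆ eT w (J⊆T w (≐-⊆ (≐-sym eJ) w h))) , B , basis-≐ eT basis ,
  λ w (b , j) → disj w (b , ≐-⊆ (≐-sym eJ) w j)

module SimilarTransport {n} {A A′ : Adj n} (R : Similar (col A) (col A′)) where
  open Similar R using (π)

  indep⁺ : ∀ I → Independent A I → Independent A′ (I ∘ʳ π)
  indep⁺ = indep-similar R

  indep⁻ : ∀ I → Independent A′ (I ∘ʳ π) → Independent A I
  indep⁻ = indep-similar⁻ R

  indep⁻′ : ∀ I′ → Independent A′ I′ → Independent A (I′ ∘ʳ π)
  indep⁻′ I′ ind = indep⁻ (I′ ∘ʳ π) (Indep-mono {F = col A′} ind (∘ʳ-∘ʳ⁻ π I′))

  rank : ∀ {S k} → IsRank A S k → IsRank A′ (S ∘ʳ π) k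
  rank {S} {k} ((I , I⊆S , ind , |I|) , bound) =
    (I ∘ʳ π , ∘ʳ-mono π I⊆S , indep⁺ I ind , trans (card-relabel π I) |I|) ,
    λ I′ I′⊆ ind′ → subst (_≤ k) (card-relabel π I′)
      (bound (I′ ∘ʳ π) (λ w h → ∘ʳ-∘ʳ⁻ π S w (I′⊆ (relabel π w) h)) (indep⁻′ I′ ind′))

  basis : ∀ {T B} → IsBasis A T B → IsBasis A′ (T ∘ʳ π) (B ∘ʳ π)
  basis {T} {B} (B⊆T , ind , maximal) =
    ∘ʳ-mono π B⊆T , indep⁺ B ind ,
    λ J′ B⊆J′ J′⊆T ind′ w h →
      maximal (J′ ∘ʳ π) (λ u hu → B⊆J′ (relabel π u) (∘ʳ-∘ʳ⁺ π B u hu))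
              (λ u hu → ∘ʳ-∘ʳ⁻ π T u (J′⊆T (relabel π u) hu)) (indep⁻′ J′ ind′)
              (relabel π w) (∘ʳ-∘ʳ⁺ π J′ w h)

  dualIndep : ∀ {T J} → DualIndependent A T J → DualIndependent A′ (T ∘ʳ π) (J ∘ʳ π)
  dualIndep (J⊆T , B , isBasis , disj) =
    ∘ʳ-mono π J⊆T , B ∘ʳ π , basis isBasis , λ w → disj (relabel π w)

ranks-invariant : Invariant RanksSumTo
ranks-invariant R (r₁ , r₂ , rank₁ , rank₂ , sum) =
  r₁ , r₂ , SimilarTransport.rank R rank₁ , SimilarTransport.rank R rank₂ , sum

directSum-invariant : Invariant DirectSumSplit
directSum-invariant {A = A} {A′} R {T₁} {T₂} split I′ I′⊆ = restrict , combine
  where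
  open Similar R using (π)
  open SimilarTransport R
  I = I′ ∘ʳ π
  I⊆ : I ⊆ (T₁ ∪ T₂)
  I⊆ w h = ∘ʳ-∘ʳ⁻ π (T₁ ∪ T₂) w (I′⊆ (relabel π w) h)
  restrict : Independent A′ I′ → Independent A′ (I′ ∩ (T₁ ∘ʳ π)) × Independent A′ (I′ ∩ (T₂ ∘ʳ π))
  restrict ind = Indep-mono {F = col A′} ind (λ w h → proj₁ (∧-true {I′ w} h)) ,
                 Indep-mono {F = col A′} ind (λ w h → proj₁ (∧-true {I′ w} h))
  part : ∀ {T} → Independent A′ (I′ ∩ (T ∘ʳ π)) → Independent A (I ∩ T)
  part {T} ind = indep⁻ (I ∩ T) (Indep-mono {F = col A′} ind
    (λ w h → let (a , b) = ∧-true {I′ (relabel π (relabel π w))} h in ∧-intro (∘ʳ-∘ʳ⁻ π I′ w a) b))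
  combine : Independent A′ (I′ ∩ (T₁ ∘ʳ π)) × Independent A′ (I′ ∩ (T₂ ∘ʳ π)) → Independent A′ I′
  combine (ind₁ , ind₂) =
    Indep-mono {F = col A′} (indep⁺ I (proj₂ (split I I⊆) (part {T₁} ind₁ , part {T₂} ind₂))) (∘ʳ-∘ʳ⁺ π I′)

isoToDual-invariant : Invariant IsoToDual
isoToDual-invariant {A = A} {A′} R {T₁} {T₂} (f , g , f∈ , g∈ , gf , fg , iso) =
  f′ , g′ , (λ w h → ∘ʳ-∘ʳ⁺ π T₂ (f (relabel π w)) (f∈ (relabel π w) h)) ,
  (λ w h → ∘ʳ-∘ʳ⁺ π T₁ (g (relabel π w)) (g∈ (relabel π w) h)) ,
  (λ w h → inverse g f gf w h) , (λ w h → inverse f g fg w h) , iso′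
  where
  open Similar R using (π)
  open SimilarTransport R
  f′ g′ : Elem _ → Elem _
  f′ w = relabel π (f (relabel π w))
  g′ w = relabel π (g (relabel π w))
  inverse : ∀ (h k : Elem _ → Elem _) {S} → (∀ w → w ∈ S → h (k w) ≡ w) →
    ∀ w → w ∈ (S ∘ʳ π) → relabel π (h (relabel π (relabel π (k (relabel π w))))) ≡ w
  inverse h k hk w w∈ =
    trans (cong (λ u → relabel π (h u)) (relabel-involutive π (k (relabel π w))))
          (trans (cong (relabel π) (hk (relabel π w) w∈)) (relabel-involutive π w))
  iso′ : ∀ I′ → I′ ⊆ (T₁ ∘ʳ π) →
    (Independent A′ I′ → DualIndependent A′ (T₂ ∘ʳ π) (λ w → (T₂ ∘ʳ π) w ∧ I′ (g′ w))) ×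
    (DualIndependent A′ (T₂ ∘ʳ π) (λ w → (T₂ ∘ʳ π) w ∧ I′ (g′ w)) → Independent A′ I′)
  iso′ I′ I′⊆ = to , from
    where
    I = I′ ∘ʳ π
    I⊆ : I ⊆ T₁
    I⊆ w h = ∘ʳ-∘ʳ⁻ π T₁ w (I′⊆ (relabel π w) h)
    to : Independent A′ I′ → DualIndependent A′ (T₂ ∘ʳ π) (λ w → (T₂ ∘ʳ π) w ∧ I′ (g′ w))
    to ind = dualIndep (proj₁ (iso I I⊆) (indep⁻′ I′ ind))
    from : DualIndependent A′ (T₂ ∘ʳ π) (λ w → (T₂ ∘ʳ π) w ∧ I′ (g′ w)) → Independent A′ I′
    from dual =
      Indep-mono {F = col A′}
        (indep⁺ I (proj₂ (iso I I⊆)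
          (dualIndep-≐ {A = A} (λ w → cong T₂ (relabel-involutive π w))
                               (λ w → cong (λ u → T₂ u ∧ I (g u)) (relabel-involutive π w))
                               (SimilarTransport.dualIndep (Similar-sym R) dual))))
        (∘ʳ-∘ʳ⁺ π I′)

entry : Label → Bool → Bool → Bool
entry φ a e = e
entry χ a e = a
entry ψ a e = a xor e

col-entry : ∀ {n} (A : Adj n) u l i → col A (u , l) i ≡ entry l (A i u) (i == u)
col-entry A u φ i = refl
col-entry A u χ i = refl
col-entry A u ψ i = refl

col-cong : ∀ {n} {A A′ : Adj n} {u} → (∀ i → A′ i u ≡ A i u) → ∀ l i → col A′ (u , l) i ≡ col A (u , l) i
col-cong e l i = trans (col-entry _ _ l i) (trans (cong (λ a → entry l a _) (e i)) (sym (col-entry _ _ l i)))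

if-not : ∀ b x → (if b then not x else x) ≡ x xor b
if-not false x = sym (xor-identityʳ x)
if-not true  false = refl
if-not true  true  = refl

opLoop-entry : ∀ {n} v (A : Adj n) i j → opLoop v A i j ≡ A i j xor ((i == v) ∧ (j == v))
opLoop-entry v A i j = if-not ((i == v) ∧ (j == v)) (A i j)

opNS-entry : ∀ {n} v (A : Adj n) i j → opNS v A i j ≡ A i j xor (isNbr A v i ∧ isNbr A v j)
opNS-entry v A i j = if-not (isNbr A v i ∧ isNbr A v j) (A i j)

opS-entry : ∀ {n} v (A : Adj n) i j → opS v A i j ≡ A i j xor (not (i == j) ∧ (isNbr A v i ∧ isNbr A v j))
opS-entry v A i j = if-not (not (i == j) ∧ (isNbr A v i ∧ isNbr A v j)) (A i j)

isNbr-self : ∀ {n} (A : Adj n) v → isNbr A v v ≡ false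
isNbr-self A v rewrite ==-refl v = refl

isNbr-other : ∀ {n} (A : Adj n) → Symmetric A → ∀ {u v} → u ≢ v → isNbr A v u ≡ A v u
isNbr-other A sym-A {u} {v} u≢v rewrite ==-distinct u≢v = sym-A u v

opLoop-symmetric : ∀ {n} {A : Adj n} → Symmetric A → ∀ v → Symmetric (opLoop v A)
opLoop-symmetric {A = A} sym-A v i j rewrite ∧-comm (i == v) (j == v) | sym-A i j = refl

opS-symmetric : ∀ {n} {A : Adj n} → Symmetric A → ∀ v → Symmetric (opS v A)
opS-symmetric {A = A} sym-A v i j
  rewrite ==-sym i j | ∧-comm (isNbr A v i) (isNbr A v j) | sym-A i j = refl

opNS-symmetric : ∀ {n} {A : Adj n} → Symmetric A → ∀ v → Symmetric (opNS v A)
opNS-symmetric {A = A} sym-A v i j rewrite ∧-comm (isNbr A v i) (isNbr A v j) | sym-A i j = refl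

LocEq-symmetric : ∀ {n} {G H : Adj n} → Symmetric G → LocEq G H → Symmetric H
LocEq-symmetric sym-G leRefl       = sym-G
LocEq-symmetric sym-G (leLoop v p) = opLoop-symmetric (LocEq-symmetric sym-G p) v
LocEq-symmetric sym-G (leS v p)    = opS-symmetric (LocEq-symmetric sym-G p) v
LocEq-symmetric sym-G (leNS v p)   = opNS-symmetric (LocEq-symmetric sym-G p) v

-- G^v_ℓ exchanges χ(v) and ψ(v) and leaves all other columns unchanged.
loopSwap : ∀ {n} → Fin n → Relabelling n
loopSwap v u = if u == v then swapχψ else keep

clear-zero : ∀ {n} (c : Fin n) (x : Vector n) i → clear c (λ _ → false) x i ≡ x i
clear-zero c x i = trans (cong (x i xor_) (∧-zeroʳ (x c))) (xor-identityʳ (x i))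

xor-cancelʳ : ∀ a b → (a xor b) xor b ≡ a
xor-cancelʳ a b = trans (xor-assoc a b b) (trans (cong (a xor_) (xor-same b)) (xor-identityʳ a))

loop-similar : ∀ {n} (A : Adj n) v → Similar (col A) (col (opLoop v A))
loop-similar A v = record { π = loopSwap v ; c = v ; N = λ _ → false ; N-c = refl ; columns = columns }
  where
  looped : ∀ i → opLoop v A i v ≡ A i v xor (i == v)
  looped i = trans (opLoop-entry v A i v)
                   (trans (cong (λ b → A i v xor ((i == v) ∧ b)) (==-refl v))
                          (cong (A i v xor_) (∧-identityʳ (i == v))))
  columns : ∀ w i → col (opLoop v A) (relabel (loopSwap v) w) i ≡ clear v (λ _ → false) (col A w) i
  columns (u , l) i with compareV u v
  ... | inj₁ refl rewrite ==-refl u = trans (at-v l) (sym (clear-zero u (col A (u , l)) i))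
    where
    at-v : ∀ l → col (opLoop u A) (u , swap swapχψ l) i ≡ col A (u , l) i
    at-v φ = refl
    at-v χ = trans (cong (_xor (i == u)) (looped i)) (xor-cancelʳ (A i u) (i == u))
    at-v ψ = looped i
  ... | inj₂ u≢v rewrite ==-distinct u≢v =
    trans (col-cong unchanged l i) (sym (clear-zero v (col A (u , l)) i))
    where
    unchanged : ∀ i → opLoop v A i u ≡ A i u
    unchanged i = trans (opLoop-entry v A i u)
                        (trans (cong (λ b → A i u xor ((i == v) ∧ b)) (==-distinct u≢v))
                               (trans (cong (A i u xor_) (∧-zeroʳ (i == v))) (xor-identityʳ (A i u))))

-- G^v_s and G^v_ns add row v to the rows of the neighbours of v, exchange
-- φ(v) with χ(v) or ψ(v) (according as v is looped or not) and, for G^v_s,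
-- exchange χ(u) and ψ(u) at every neighbour u of v.

pivotSwap : ∀ {n} → Adj n → Fin n → LabelSwap
pivotSwap A v = if A v v then swapφχ else swapφψ

nsSwap : ∀ {n} → Adj n → Fin n → Relabelling n
nsSwap A v u = if u == v then pivotSwap A v else keep

sSwap : ∀ {n} → Adj n → Fin n → Relabelling n
sSwap A v u = if u == v then pivotSwap A v else (if isNbr A v u then swapχψ else keep)

-- Entry identities for the column of v (e = [i = v], nb = [i is a neighbour of v]).
pivot-entry : ∀ avv l a e nb → (e ≡ true → (a ≡ avv) × (nb ≡ false)) → (e ≡ false → nb ≡ a) →
  entry (swap (if avv then swapφχ else swapφψ) l) a e ≡ entry l a e xor (entry l avv true ∧ nb)
pivot-entry avv l a true nb at-v _ with at-v refl
... | refl , refl = trans (diagonal avv l) (sym (trans (cong (entry l avv true xor_) (∧-zeroʳ _)) (xor-identityʳ _)))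
  where
  diagonal : ∀ avv l → entry (swap (if avv then swapφχ else swapφψ) l) avv true ≡ entry l avv true
  diagonal true  φ = refl
  diagonal true  χ = refl
  diagonal true  ψ = refl
  diagonal false φ = refl
  diagonal false χ = refl
  diagonal false ψ = refl
pivot-entry avv l a false nb _ off-v with off-v refl
... | refl = off-diagonal avv l a
  where
  off-diagonal : ∀ avv l a → entry (swap (if avv then swapφχ else swapφψ) l) a false ≡
                             entry l a false xor (entry l avv true ∧ a)
  off-diagonal true  φ a = refl
  off-diagonal true  χ a = sym (xor-same a)
  off-diagonal true  ψ a = sym (xor-identityʳ _)
  off-diagonal false φ a = xor-identityʳ a
  off-diagonal false χ a = sym (xor-identityʳ a)
  off-diagonal false ψ a = sym (trans (cong (_xor a) (xor-identityʳ a)) (xor-same a))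

-- Entry identity for the column of u ≠ v in G^v_ns (nu = [u is a neighbour of v]).
ns-entry : ∀ l a e nb nu → entry l (a xor (nb ∧ nu)) e ≡ entry l a e xor (entry l nu false ∧ nb)
ns-entry φ a e nb nu = sym (xor-identityʳ e)
ns-entry χ a e nb nu = cong (a xor_) (∧-comm nb nu)
ns-entry ψ a e nb nu rewrite xor-identityʳ nu | ∧-comm nb nu =
  trans (xor-assoc a _ e) (trans (cong (a xor_) (xor-comm _ e)) (sym (xor-assoc a e _)))

-- Entry identity for the column of u ≠ v in G^v_s; a neighbour u of v has
-- its χ and ψ columns exchanged.
s-entry : ∀ l a e nb nu → (e ≡ true → nb ≡ nu) →
  entry (swap (if nu then swapχψ else keep) l) (a xor (not e ∧ (nb ∧ nu))) e ≡ entry l a e xor (entry l nu false ∧ nb)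
s-entry l a e nb false _ rewrite ∧-zeroʳ nb | ∧-zeroʳ (not e) | xor-identityʳ a =
  sym (trans (cong (entry l a e xor_) (empty-entry l)) (xor-identityʳ _))
  where
  empty-entry : ∀ l → entry l false false ∧ nb ≡ false
  empty-entry φ = refl
  empty-entry χ = refl
  empty-entry ψ = refl
s-entry φ a e nb true _ = sym (xor-identityʳ e)
s-entry χ a true  nb true same with same refl
... | refl = cong (_xor true) (xor-identityʳ a)
s-entry χ a false nb true _ rewrite ∧-identityʳ nb = xor-identityʳ (a xor nb)
s-entry ψ a true  nb true same with same refl
... | refl = trans (xor-identityʳ a) (sym (xor-cancelʳ a true))
s-entry ψ a false nb true _ rewrite ∧-identityʳ nb | xor-identityʳ a = refl

clear-col : ∀ {n} (A : Adj n) (N : Vector n) v u l i →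
  clear v N (col A (u , l)) i ≡ entry l (A i u) (i == u) xor (entry l (A v u) (v == u) ∧ N i)
clear-col A N v u l i = cong₂ (λ x y → x xor (y ∧ N i)) (col-entry A u l i) (col-entry A u l v)

pivot-column : ∀ {n} (A A′ : Adj n) v → (∀ i → A′ i v ≡ A i v) → ∀ l i →
  col A′ (v , swap (pivotSwap A v) l) i ≡ clear v (isNbr A v) (col A (v , l)) i
pivot-column A A′ v fixed l i =
  trans (col-entry A′ v (swap (pivotSwap A v) l) i)
  (trans (cong (λ a → entry (swap (pivotSwap A v) l) a (i == v)) (fixed i))
  (trans (pivot-entry (A v v) l (A i v) (i == v) (isNbr A v i) at-v off-v)
         (sym (trans (clear-col A (isNbr A v) v v l i)
                     (cong (λ e → entry l (A i v) (i == v) xor (entry l (A v v) e ∧ isNbr A v i)) (==-refl v))))))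
  where
  at-v : (i == v) ≡ true → (A i v ≡ A v v) × (isNbr A v i ≡ false)
  at-v e with ==-sound e
  ... | refl = refl , isNbr-self A i
  off-v : (i == v) ≡ false → isNbr A v i ≡ A i v
  off-v e rewrite e = refl

ns-similar : ∀ {n} (A : Adj n) → Symmetric A → ∀ v → Similar (col A) (col (opNS v A))
ns-similar A sym-A v =
  record { π = nsSwap A v ; c = v ; N = isNbr A v ; N-c = isNbr-self A v ; columns = columns }
  where
  fixed : ∀ i → opNS v A i v ≡ A i v
  fixed i = trans (opNS-entry v A i v)
                  (trans (cong (λ b → A i v xor (isNbr A v i ∧ b)) (isNbr-self A v))
                         (trans (cong (A i v xor_) (∧-zeroʳ (isNbr A v i))) (xor-identityʳ (A i v))))
  columns : ∀ w i → col (opNS v A) (relabel (nsSwap A v) w) i ≡ clear v (isNbr A v) (col A w) i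
  columns (u , l) i with compareV u v
  ... | inj₁ refl rewrite ==-refl u = pivot-column A (opNS u A) u fixed l i
  ... | inj₂ u≢v =
    trans (cong (λ s → col (opNS v A) (u , swap s l) i) keep-at-u)
    (trans (col-entry (opNS v A) u l i)
    (trans (cong (λ a → entry l a (i == u)) (opNS-entry v A i u))
    (trans (ns-entry l (A i u) (i == u) (isNbr A v i) (isNbr A v u))
           (sym (trans (clear-col A (isNbr A v) v u l i)
                       (cong₂ (λ a e → entry l (A i u) (i == u) xor (entry l a e ∧ isNbr A v i))
                              (sym (isNbr-other A sym-A u≢v)) (==-distinct (λ v≡u → u≢v (sym v≡u)))))))))
    where
    keep-at-u : nsSwap A v u ≡ keep
    keep-at-u rewrite ==-distinct u≢v = refl

s-similar : ∀ {n} (A : Adj n) → Symmetric A → ∀ v → Similar (col A) (col (opS v A))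
s-similar A sym-A v =
  record { π = sSwap A v ; c = v ; N = isNbr A v ; N-c = isNbr-self A v ; columns = columns }
  where
  fixed : ∀ i → opS v A i v ≡ A i v
  fixed i = trans (opS-entry v A i v)
                  (trans (cong (λ b → A i v xor (not (i == v) ∧ (isNbr A v i ∧ b))) (isNbr-self A v))
                         (trans (cong (λ b → A i v xor (not (i == v) ∧ b)) (∧-zeroʳ (isNbr A v i)))
                                (trans (cong (A i v xor_) (∧-zeroʳ (not (i == v)))) (xor-identityʳ (A i v)))))
  columns : ∀ w i → col (opS v A) (relabel (sSwap A v) w) i ≡ clear v (isNbr A v) (col A w) i
  columns (u , l) i with compareV u v
  ... | inj₁ refl rewrite ==-refl u = pivot-column A (opS u A) u fixed l i
  ... | inj₂ u≢v =
    trans (cong (λ s → col (opS v A) (u , swap s l) i) swap-at-u)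
    (trans (col-entry (opS v A) u (swap (nbrSwap u) l) i)
    (trans (cong (λ a → entry (swap (nbrSwap u) l) a (i == u)) (opS-entry v A i u))
    (trans (s-entry l (A i u) (i == u) (isNbr A v i) (isNbr A v u) same-nbr)
           (sym (trans (clear-col A (isNbr A v) v u l i)
                       (cong₂ (λ a e → entry l (A i u) (i == u) xor (entry l a e ∧ isNbr A v i))
                              (sym (isNbr-other A sym-A u≢v)) (==-distinct (λ v≡u → u≢v (sym v≡u)))))))))
    where
    nbrSwap : Fin _ → LabelSwap
    nbrSwap u = if isNbr A v u then swapχψ else keep
    swap-at-u : sSwap A v u ≡ nbrSwap u
    swap-at-u rewrite ==-distinct u≢v = refl
    same-nbr : (i == u) ≡ true → isNbr A v i ≡ isNbr A v u
    same-nbr e rewrite ==-sound e = refl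

LocEq-reflects : ∀ {n} (C : Adj n → Set) → (∀ {A A′ : Adj n} → Similar (col A) (col A′) → C A → C A′) →
  ∀ {G H : Adj n} → Symmetric G → LocEq G H → C H → C G
LocEq-reflects C transport sym-G leRefl c = c
LocEq-reflects C transport sym-G (leLoop {H} v p) c =
  LocEq-reflects C transport sym-G p (transport (Similar-sym (loop-similar H v)) c)
LocEq-reflects C transport sym-G (leS {H} v p) c =
  LocEq-reflects C transport sym-G p (transport (Similar-sym (s-similar H (LocEq-symmetric sym-G p) v)) c)
LocEq-reflects C transport sym-G (leNS {H} v p) c =
  LocEq-reflects C transport sym-G p (transport (Similar-sym (ns-similar H (LocEq-symmetric sym-G p) v)) c)

-- The φ-columns of IAS(G) are the unit vectors.

isφ : Label → Bool
isφ φ = true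
isφ χ = false
isφ ψ = false

φPart : ∀ {n} → Sub n → Sub n
φPart T (v , l) = isφ l ∧ T (v , φ)

φPart-⊆ : ∀ {n} (T : Sub n) → φPart T ⊆ T
φPart-⊆ T (v , φ) h = h

card-φPart : ∀ {n} (T : Sub n) → card (φPart T) ≡ sumFin (λ v → indicator (T (v , φ)))
card-φPart T = sumFin-cong (λ v → +-identityʳ (indicator (T (v , φ))))

combo-col : ∀ {n} (A : Adj n) (D : Sub n) i → combo (col A) D i ≡
  D (i , φ) xor (xorFin (λ v → D (v , χ) ∧ A i v) xor xorFin (λ v → D (v , ψ) ∧ (A i v xor (i == v))))
combo-col A D i =
  trans (xorFin-hom (λ v → D (v , φ) ∧ (i == v)) (λ v → (D (v , χ) ∧ A i v) xor (D (v , ψ) ∧ (A i v xor (i == v)))))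
    (cong₂ _xor_
      (trans (xorFin-single i (λ v → D (v , φ) ∧ (i == v))
                            (λ v v≢i → trans (cong (D (v , φ) ∧_) (==-distinct (λ i≡v → v≢i (sym i≡v)))) (∧-zeroʳ _)))
             (trans (cong (D (i , φ) ∧_) (==-refl i)) (∧-identityʳ _)))
      (xorFin-hom (λ v → D (v , χ) ∧ A i v) (λ v → D (v , ψ) ∧ (A i v xor (i == v)))))

combo-φ : ∀ {n} (A : Adj n) (D : Sub n) → (∀ w → w ∈ D → isφ (proj₂ w) ≡ true) →
  ∀ i → combo (col A) D i ≡ D (i , φ)
combo-φ A D only-φ i =
  trans (combo-col A D i)
        (trans (cong₂ (λ x y → D (i , φ) xor (x xor y)) (xorFin-zero _ (no-χ i)) (xorFin-zero _ (no-ψ i)))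
               (xor-identityʳ _))
  where
  absent : ∀ v l → isφ l ≡ false → D (v , l) ≡ false
  absent v l nonφ with D (v , l) in e
  ... | false = refl
  ... | true  = ⊥-elim (false≢true (trans (sym nonφ) (only-φ (v , l) e)))
  no-χ : ∀ i v → D (v , χ) ∧ A i v ≡ false
  no-χ i v = cong (_∧ A i v) (absent v χ refl)
  no-ψ : ∀ i v → D (v , ψ) ∧ (A i v xor (i == v)) ≡ false
  no-ψ i v = cong (_∧ (A i v xor (i == v))) (absent v ψ refl)

φ-spans : ∀ {n} (A : Adj n) (x : Vector n) → InSpan (col A) (φPart (λ _ → true)) x
φ-spans A x = φPart x′ , (λ { (v , φ) _ → refl }) , combo-φ A (φPart x′) (λ { (v , φ) _ → refl })
  where
  x′ : Sub _
  x′ (v , _) = x v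

·-φ : ∀ {n} (A : Adj n) (u : Vector n) v → u · col A (v , φ) ≡ u v
·-φ A u v = trans (xorFin-single v _ (λ j j≢v → trans (cong (u j ∧_) (==-distinct j≢v)) (∧-zeroʳ (u j))))
                  (trans (cong (u v ∧_) (==-refl v)) (∧-identityʳ (u v)))

φPart-indep : ∀ {n} (A : Adj n) (T : Sub n) → Independent A (φPart T)
φPart-indep A T D D⊆ ((x , l) , w∈D) vanishes with isφ l in e | D⊆ (x , l) w∈D
... | true  | _ = false≢true (trans (sym (vanishes x)) (trans (combo-φ A D only-φ x) (at-x l e w∈D)))
  where
  only-φ : ∀ w → w ∈ D → isφ (proj₂ w) ≡ true
  only-φ w h = proj₁ (∧-true {isφ (proj₂ w)} (D⊆ w h))
  at-x : ∀ l → isφ l ≡ true → D (x , l) ≡ true → D (x , φ) ≡ true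
  at-x φ _ h = h
... | false | h = false≢true h

-- Every independent set has at most n elements (the φ-columns span GF(2)^n).
indep-≤-n : ∀ {n} (A : Adj n) I → Independent A I → card I ≤ n
indep-≤-n {n} A I ind =
  subst (card I ≤_) (trans (card-φPart {n} (λ _ → true)) (sumFin-ones n))
        (steinitz (col A) (col A) I (φPart (λ _ → true)) ind (λ w _ → φ-spans A (col A w)))

module Bipartition {n} (H : Adj n) where

  Proper : (Fin n → Bool) → Set
  Proper c = ∀ i j → H i j ≡ true → c i ≢ c j

  flip : (Fin n → Bool) → Fin n → Bool
  flip c v = not (c v)

  flip-proper : ∀ c → Proper c → Proper (flip c)
  flip-proper c proper i j h e = proper i j h (trans (sym (not-involutive (c i)))
                                                      (trans (cong not e) (not-involutive (c j))))

  side : (Fin n → Bool) → Sub n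
  side c (v , φ) = c v
  side c (v , χ) = not (c v)
  side c (v , ψ) = false

  side-transversal : ∀ c → Transversal (side c)
  side-transversal c v with c v
  ... | true  = refl
  ... | false = refl

  sides-disjoint : ∀ c → Disjoint (side c) (side (flip c))
  sides-disjoint c (v , φ) (a , b) rewrite a with b
  ... | ()
  sides-disjoint c (v , χ) (a , b) rewrite not-involutive (c v) | b with a
  ... | ()

  side-support : ∀ c → Proper c → ∀ w → w ∈ side c → ∀ i → col H w i ≡ true → c i ≡ true
  side-support c proper (v , φ) h i e rewrite ==-sound {x = i} {y = v} e = h
  side-support c proper (v , χ) h i e with c i in ci
  ... | true  = refl
  ... | false = ⊥-elim (proper i v e (trans ci (sym (trans (sym (not-involutive (c v))) (cong not h)))))

  classSize : (Fin n → Bool) → ℕ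
  classSize c = sumFin (λ v → indicator (c v))

  classSizes : ∀ c → classSize c + classSize (flip c) ≡ n
  classSizes c = trans (sym (sumFin-hom (λ v → indicator (c v)) (λ v → indicator (flip c v))))
                       (trans (sumFin-cong one) (sumFin-ones n))
    where
    one : ∀ v → indicator (c v) + indicator (flip c v) ≡ 1
    one v with c v
    ... | true  = refl
    ... | false = refl

  -- r(side c) = |c|: the φ-columns of the class are a basis of M|side c
  side-rank : ∀ c → Proper c → IsRank H (side c) (classSize c)
  side-rank c proper =
    (φPart (side c) , φPart-⊆ (side c) , φPart-indep H (side c) , card-φPart (side c)) ,
    λ I I⊆ ind → subst (card I ≤_) (card-φPart (side c))
                   (steinitz (col H) (col H) I (φPart (side c)) ind (λ w w∈I → spanned w (I⊆ w w∈I)))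
    where
    spanned : ∀ w → w ∈ side c → InSpan (col H) (φPart (side c)) (col H w)
    spanned w w∈ = D , D⊆ , λ i → trans (combo-φ H D (λ { (v , φ) _ → refl }) i) (restricted i)
      where
      D : Sub n
      D (v , l) = isφ l ∧ (c v ∧ col H w v)
      D⊆ : D ⊆ φPart (side c)
      D⊆ (v , φ) h = proj₁ (∧-true {c v} h)
      restricted : ∀ i → c i ∧ col H w i ≡ col H w i
      restricted i with col H w i in e
      ... | false = ∧-zeroʳ (c i)
      ... | true rewrite side-support c proper w w∈ i e = refl

  ranks : ∀ c → Proper c → RanksSumTo H (side c) (side (flip c))
  ranks c proper = classSize c , classSize (flip c) ,
    side-rank c proper , side-rank (flip c) (flip-proper c proper) , classSizes c

  combo-outside : ∀ (D : Sub n) i → (∀ w → w ∈ D → col H w i ≡ true → ⊥) → combo (col H) D i ≡ false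
  combo-outside D i outside = sumW-zero (λ w → D w ∧ col H w i) term
    where
    term : ∀ w → D w ∧ col H w i ≡ false
    term w with D w in e | col H w i in e′
    ... | false | _     = refl
    ... | true  | false = refl
    ... | true  | true  = ⊥-elim (outside w e e′)

  -- M|(side c ∪ side (flip c)) is the direct sum, as the two sides have
  -- disjointly supported columns
  sides-directSum : ∀ c → Proper c → DirectSumSplit H (side c) (side (flip c))
  sides-directSum c proper I I⊆ = restrict , combine
    where
    restrict : Independent H I → Independent H (I ∩ side c) × Independent H (I ∩ side (flip c))
    restrict ind = Indep-mono {F = col H} ind (λ w h → proj₁ (∧-true {I w} h)) ,
                   Indep-mono {F = col H} ind (λ w h → proj₁ (∧-true {I w} h))
    combine : Independent H (I ∩ side c) × Independent H (I ∩ side (flip c)) → Independent H I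
    combine (ind₁ , ind₂) D D⊆I (w₀ , w₀∈D) vanishes = contradiction
      where
      D₁ D₂ : Sub n
      D₁ w = D w ∧ side c w
      D₂ w = D w ∧ side (flip c) w
      split : ∀ w → D w ≡ D₁ w xor D₂ w
      split w with D w in e
      ... | false = refl
      ... | true  = by-side w (I⊆ w (D⊆I w e))
        where
        by-side : ∀ w → (side c w ∨ side (flip c) w) ≡ true → true ≡ side c w xor side (flip c) w
        by-side (v , φ) _ with c v
        ... | true  = refl
        ... | false = refl
        by-side (v , χ) _ with c v
        ... | true  = refl
        ... | false = refl
        by-side (v , ψ) ()
      vanishes-sum : ∀ i → combo (col H) D₁ i xor combo (col H) D₂ i ≡ false
      vanishes-sum i = trans (sym (trans (combo-cong (col H) split i) (combo-hom (col H) D₁ D₂ i))) (vanishes i)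
      outside₁ : ∀ i → c i ≡ false → combo (col H) D₁ i ≡ false
      outside₁ i ci = combo-outside D₁ i λ w h e →
        false≢true (trans (sym ci) (side-support c proper w (proj₂ (∧-true {D w} h)) i e))
      outside₂ : ∀ i → c i ≡ true → combo (col H) D₂ i ≡ false
      outside₂ i ci = combo-outside D₂ i λ w h e →
        false≢true (trans (sym (cong not ci)) (side-support (flip c) (flip-proper c proper) w (proj₂ (∧-true {D w} h)) i e))
      vanishes₁ : ∀ i → combo (col H) D₁ i ≡ false
      vanishes₁ i with c i in ci
      ... | false = outside₁ i ci
      ... | true  = trans (sym (xor-identityʳ _))
                          (trans (cong (combo (col H) D₁ i xor_) (sym (outside₂ i ci))) (vanishes-sum i))
      vanishes₂ : ∀ i → combo (col H) D₂ i ≡ false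
      vanishes₂ i with c i in ci
      ... | true  = outside₂ i ci
      ... | false = trans (cong (_xor combo (col H) D₂ i) (sym (outside₁ i ci))) (vanishes-sum i)
      D₁⊆ : D₁ ⊆ (I ∩ side c)
      D₁⊆ w h = let (a , b) = ∧-true {D w} h in ∧-intro (D⊆I w a) b
      D₂⊆ : D₂ ⊆ (I ∩ side (flip c))
      D₂⊆ w h = let (a , b) = ∧-true {D w} h in ∧-intro (D⊆I w a) b
      contradiction : ⊥
      contradiction with D₁ w₀ in e₁ | D₂ w₀ in e₂
      ... | true  | _     = ind₁ D₁ D₁⊆ (w₀ , e₁) vanishes₁
      ... | false | true  = ind₂ D₂ D₂⊆ (w₀ , e₂) vanishes₂
      ... | false | false = false≢true (trans (sym (trans (split w₀) (cong₂ _xor_ e₁ e₂))) w₀∈D)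

-- The duality M|side c ≅ (M|side (flip c))* for a properly coloured H,
-- induced by exchanging φ(v) and χ(v).
module SidesDual {n} (H : Adj n) (sym-H : Symmetric H) (c : Fin n → Bool)
                 (proper : Bipartition.Proper H c) where
  open Bipartition H

  T₁ T₂ : Sub n
  T₁ = side c
  T₂ = side (flip c)

  exchange : Elem n → Elem n
  exchange = relabel (λ _ → swapφχ)

  exchange-involutive : ∀ w → exchange (exchange w) ≡ w
  exchange-involutive = relabel-involutive (λ _ → swapφχ)

  exchange-T₁ : ∀ w → w ∈ T₁ → exchange w ∈ T₂
  exchange-T₁ (v , φ) h = trans (not-involutive (c v)) h
  exchange-T₁ (v , χ) h = h

  exchange-T₂ : ∀ w → w ∈ T₂ → exchange w ∈ T₁
  exchange-T₂ (v , φ) h = h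
  exchange-T₂ (v , χ) h = trans (sym (not-involutive (c v))) h

  Outside : Sub n → Sub n
  Outside I w = T₂ w ∧ not (I (exchange w))

  Annihilates : Sub n → Vector n → Set
  Annihilates I u = ∀ w → w ∈ Outside I → u · col H w ≡ false

  functional⇒dependency : ∀ I (u : Vector n) → Annihilates I u →
    ∀ w → w ∈ T₂ → I (exchange w) ≡ true → u · col H w ≡ true → ¬ Independent H I
  functional⇒dependency I u u⊥ w w∈T₂ w∈I uw ind = ind D D⊆I (witness w w∈T₂ w∈I uw) vanishes
    where
    D : Sub n
    D (v , φ) = c v ∧ (u · col H (v , χ))
    D (v , χ) = not (c v) ∧ u v
    D (v , ψ) = false
    -- an element of D outside I would put its exchange in Outside I, where u vanishes
    D⊆I : D ⊆ I
    D⊆I (v , φ) h with I (v , φ) in e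
    ... | true  = refl
    ... | false = ⊥-elim (false≢true (trans (sym (u⊥ (v , χ) χ-outside)) (proj₂ (∧-true {c v} h))))
      where
      χ-outside : (v , χ) ∈ Outside I
      χ-outside = ∧-intro (trans (not-involutive (c v)) (proj₁ (∧-true {c v} h))) (cong not e)
    D⊆I (v , χ) h with I (v , χ) in e
    ... | true  = refl
    ... | false =
      ⊥-elim (false≢true (trans (sym (u⊥ (v , φ) φ-outside)) (trans (·-φ H u v) (proj₂ (∧-true {not (c v)} h)))))
      where
      φ-outside : (v , φ) ∈ Outside I
      φ-outside = ∧-intro (proj₁ (∧-true {not (c v)} h)) (cong not e)
    witness : ∀ w → w ∈ T₂ → I (exchange w) ≡ true → u · col H w ≡ true → ∃ λ w′ → w′ ∈ D
    witness (v , φ) w∈T₂ _ uw = (v , χ) , ∧-intro w∈T₂ (trans (sym (·-φ H u v)) uw)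
    witness (v , χ) w∈T₂ _ uw = (v , φ) , ∧-intro (exchange-T₂ (v , χ) w∈T₂) uw
    -- row i: in the class c, the φ-entry cancels the χ-entries; outside it, both vanish
    in-class : ∀ i → c i ≡ true → ∀ v → (not (c v) ∧ u v) ∧ H i v ≡ u v ∧ H v i
    in-class i ci v with c v in cv
    ... | false = cong (u v ∧_) (sym-H i v)
    ... | true with H i v in e
    ...   | true  = ⊥-elim (proper i v e (trans ci (sym cv)))
    ...   | false = trans (sym (∧-zeroʳ (u v))) (cong (u v ∧_) (trans (sym e) (sym-H i v)))
    off-class : ∀ i → c i ≡ false → ∀ v → (not (c v) ∧ u v) ∧ H i v ≡ false
    off-class i ci v with c v in cv
    ... | true  = refl
    ... | false with H i v in e
    ...   | false = ∧-zeroʳ _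
    ...   | true  = ⊥-elim (proper i v e (trans ci (sym cv)))
    row : ∀ i b → c i ≡ b → D (i , φ) xor xorFin (λ v → D (v , χ) ∧ H i v) ≡ false
    row i true  ci rewrite ci =
      trans (cong ((u · col H (i , χ)) xor_) (xorFin-cong (in-class i ci))) (xor-same (u · col H (i , χ)))
    row i false ci rewrite ci = xorFin-zero _ (off-class i ci)
    vanishes : ∀ i → combo (col H) D i ≡ false
    vanishes i =
      trans (combo-col H D i)
      (trans (cong (λ s → D (i , φ) xor (xorFin (λ v → D (v , χ) ∧ H i v) xor s)) (xorFin-zero {n} _ (λ v → refl)))
      (trans (cong (D (i , φ) xor_) (xor-identityʳ _)) (row i (c i) refl)))

  dependency⇒functional : ∀ I → I ⊆ T₁ → ∀ D → D ⊆ I → (∃ λ w → w ∈ D) → (∀ i → combo (col H) D i ≡ false) →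
    ∃ λ u → Annihilates I u × ∃ λ w → w ∈ T₂ × u · col H w ≡ true
  dependency⇒functional I I⊆T₁ D D⊆I (w₀ , w₀∈D) vanishes = u , u⊥ , witness w₀ w₀∈D
    where
    u : Vector n
    u v = not (c v) ∧ D (v , χ)
    absent : ∀ w → I w ≡ false → D w ≡ false
    absent w Iw with D w in e
    ... | false = refl
    ... | true  = ⊥-elim (false≢true (trans (sym Iw) (D⊆I w e)))
    no-ψ : ∀ v → D (v , ψ) ≡ false
    no-ψ v with D (v , ψ) in e
    ... | false = refl
    ... | true with I⊆T₁ _ (D⊆I _ e)
    ...   | ()
    χ-off-class : ∀ v → D (v , χ) ≡ true → c v ≡ false
    χ-off-class v h with c v in cv
    ... | false = refl
    ... | true  = ⊥-elim (false≢true (trans (sym (cong not cv)) (I⊆T₁ _ (D⊆I _ h))))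
    row : ∀ x → D (x , φ) xor xorFin (λ j → D (j , χ) ∧ H x j) ≡ false
    row x = trans (sym (trans (combo-col H D x)
                              (cong (D (x , φ) xor_)
                                    (trans (cong (xorFin (λ v → D (v , χ) ∧ H x v) xor_)
                                                 (xorFin-zero _ (λ v → cong (_∧ (H x v xor (x == v))) (no-ψ v))))
                                           (xor-identityʳ _)))))
                  (vanishes x)
    u-χ : ∀ v → u · col H (v , χ) ≡ xorFin (λ j → D (j , χ) ∧ H v j)
    u-χ v = xorFin-cong term
      where
      term : ∀ j → (not (c j) ∧ D (j , χ)) ∧ H j v ≡ D (j , χ) ∧ H v j
      term j with D (j , χ) in e
      ... | false = cong (_∧ H j v) (∧-zeroʳ (not (c j)))
      ... | true rewrite χ-off-class j e = sym-H j v
    u⊥ : Annihilates I u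
    u⊥ (v , φ) h = trans (·-φ H u v)
      (trans (cong (not (c v) ∧_) (absent (v , χ) (not-true (proj₂ (∧-true {T₂ (v , φ)} h))))) (∧-zeroʳ _))
    u⊥ (v , χ) h = trans (u-χ v)
      (trans (sym (cong (_xor xorFin (λ j → D (j , χ) ∧ H v j)) (absent (v , φ) (not-true (proj₂ (∧-true {T₂ (v , χ)} h))))))
             (row v))
    witness : ∀ w → w ∈ D → ∃ λ w′ → w′ ∈ T₂ × u · col H w′ ≡ true
    witness (v , φ) h = (v , χ) , exchange-T₁ (v , φ) (I⊆T₁ _ (D⊆I _ h)) , trans (u-χ v) (xor-true h (row v))
    witness (v , χ) h = (v , φ) , cong not (χ-off-class v h) ,
                        trans (·-φ H u v) (∧-intro (cong not (χ-off-class v h)) h)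
    witness (v , ψ) h = ⊥-elim (false≢true (trans (sym (no-ψ v)) h))

  image : Sub n → Sub n
  image I w = T₂ w ∧ I (exchange w)

  -- For independent I, a basis of M|Outside I is a basis of M|T₂ avoiding image I.
  independent⇒dual : ∀ I → Independent H I → DualIndependent H T₂ (image I)
  independent⇒dual I ind =
    (λ w h → proj₁ (∧-true {T₂ w} h)) , B , spanning-basis H T₂ B B⊆T₂ B-indep spans-T₂ , disjoint
    where
    basisOutside = greedy-basis (col H) (Outside I)
    B = proj₁ basisOutside
    B⊆Outside : B ⊆ Outside I
    B⊆Outside = proj₁ (proj₂ basisOutside)
    B-indep : Independent H B
    B-indep = proj₁ (proj₂ (proj₂ basisOutside))
    spans-Outside : ∀ w → w ∈ Outside I → InSpan (col H) B (col H w)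
    spans-Outside = proj₂ (proj₂ (proj₂ basisOutside))
    B⊆T₂ : B ⊆ T₂
    B⊆T₂ w h = proj₁ (∧-true {T₂ w} (B⊆Outside w h))
    disjoint : Disjoint B (image I)
    disjoint w (w∈B , w∈image) =
      false≢true (trans (sym (cong not (proj₂ (∧-true {T₂ w} w∈image)))) (proj₂ (∧-true {T₂ w} (B⊆Outside w w∈B))))
    spans-T₂ : ∀ w → w ∈ T₂ → InSpan (col H) B (col H w)
    spans-T₂ w w∈T₂ with I (exchange w) in e
    ... | false = spans-Outside w (∧-intro w∈T₂ (cong not e))
    ... | true with span-decide (col H) B (col H w)
    ...   | inj₁ spanned          = spanned
    ...   | inj₂ (u , u⊥B , uw) =
      ⊥-elim (functional⇒dependency I u (λ w′ h → span-annihilated u (spans-Outside w′ h) u⊥B) w w∈T₂ e uw ind)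

  dual⇒independent : ∀ I → I ⊆ T₁ → DualIndependent H T₂ (image I) → Independent H I
  dual⇒independent I I⊆T₁ (_ , B , basis , disjoint) D D⊆I nonempty vanishes
    with dependency⇒functional I I⊆T₁ D D⊆I nonempty vanishes
  ... | u , u⊥ , w , w∈T₂ , uw =
    false≢true (trans (sym (span-annihilated u (basis-spans H T₂ B basis w w∈T₂) u⊥B)) uw)
    where
    u⊥B : ∀ b → b ∈ B → u · col H b ≡ false
    u⊥B b b∈B with I (exchange b) in e
    ... | false = u⊥ b (∧-intro (proj₁ basis b b∈B) (cong not e))
    ... | true  = ⊥-elim (disjoint b (b∈B , ∧-intro (proj₁ basis b b∈B) e))

  sides-isoToDual : IsoToDual H T₁ T₂
  sides-isoToDual =
    exchange , exchange , exchange-T₁ , exchange-T₂ ,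
    (λ w _ → exchange-involutive w) , (λ w _ → exchange-involutive w) ,
    λ I I⊆T₁ → independent⇒dual I , dual⇒independent I I⊆T₁

-- r(T₁) + r(T₂) ≤ |V(G)|, phrased with independent subsets.
RankBound : ∀ {n} → Adj n → Sub n → Sub n → Set
RankBound {n} A T₁ T₂ =
  ∀ I K → I ⊆ T₁ → Independent A I → K ⊆ T₂ → Independent A K → card I + card K ≤ n

ranks⇒bound : ∀ {n} (A : Adj n) T₁ T₂ → RanksSumTo A T₁ T₂ → RankBound A T₁ T₂
ranks⇒bound A T₁ T₂ (r₁ , r₂ , rank₁ , rank₂ , sum) I K I⊆ indI K⊆ indK =
  subst (card I + card K ≤_) sum (+-mono-≤ (proj₂ rank₁ I I⊆ indI) (proj₂ rank₂ K K⊆ indK))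

-- in a direct sum, I ∪ K is independent
directSum⇒bound : ∀ {n} (A : Adj n) T₁ T₂ → Disjoint T₁ T₂ → DirectSumSplit A T₁ T₂ → RankBound A T₁ T₂
directSum⇒bound {n} A T₁ T₂ disj split I K I⊆ indI K⊆ indK =
  subst (_≤ n) |U| (indep-≤-n A U U-indep)
  where
  U = λ w → I w ∨ K w
  U⊆ : U ⊆ (T₁ ∪ T₂)
  U⊆ w h with ∨-true {I w} h
  ... | inj₁ w∈I = ∨-introˡ (I⊆ w w∈I)
  ... | inj₂ w∈K = ∨-introʳ {T₁ w} (K⊆ w w∈K)
  K∉T₁ : ∀ w → w ∈ K → T₁ w ≡ false
  K∉T₁ w w∈K with T₁ w in e
  ... | false = refl
  ... | true  = ⊥-elim (disj w (e , K⊆ w w∈K))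
  U∩T₁ : ∀ w → (U w ∧ T₁ w) ≡ I w
  U∩T₁ w with I w in eI | K w in eK
  ... | true  | _     rewrite I⊆ w eI   = refl
  ... | false | true  rewrite K∉T₁ w eK = refl
  ... | false | false = refl
  U∖T₁ : ∀ w → (U w ∧ not (T₁ w)) ≡ K w
  U∖T₁ w with I w in eI | K w in eK
  ... | true  | true  = ⊥-elim (disj w (I⊆ w eI , K⊆ w eK))
  ... | true  | false rewrite I⊆ w eI   = refl
  ... | false | true  rewrite K∉T₁ w eK = refl
  ... | false | false = refl
  U∩T₂⊆K : (U ∩ T₂) ⊆ K
  U∩T₂⊆K w h with I w in eI | K w in eK
  ... | _     | true  = refl
  ... | true  | false = ⊥-elim (disj w (I⊆ w eI , h))
  ... | false | false = ⊥-elim (false≢true h)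
  U-indep : Independent A U
  U-indep = proj₂ (split U U⊆) (Indep-mono {F = col A} indI (λ w h → trans (sym (U∩T₁ w)) h) ,
                                Indep-mono {F = col A} indK U∩T₂⊆K)
  |U| : card U ≡ card I + card K
  |U| = trans (card-split U T₁) (cong₂ _+_ (card-cong U∩T₁) (card-cong U∖T₁))

-- If M|T₁ ≅ (M|T₂)*, then |I| = |image of I| and a basis of M|T₂ avoiding
-- that image has at most n - |I| elements and bounds |K|.
isoToDual⇒bound : ∀ {n} (A : Adj n) T₁ T₂ → Transversal T₂ → IsoToDual A T₁ T₂ → RankBound A T₁ T₂
isoToDual⇒bound {n} A T₁ T₂ t₂ (f , g , f∈ , g∈ , gf , fg , iso) I K I⊆ indI K⊆ indK
  with proj₁ (iso I I⊆) indI
... | _ , B , basis , disjoint =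
  subst (card I + card K ≤_) (sym |T₂|) (+-mono-≤ |I|≤ (≤-trans |K|≤|B| |B|≤))
  where
  Image    = λ w → T₂ w ∧ I (g w)
  NotImage = λ w → T₂ w ∧ not (I (g w))
  |T₂| : n ≡ card Image + card NotImage
  |T₂| = trans (sym (card-transversal T₂ t₂)) (card-split T₂ (λ w → I (g w)))
  |I|≤ : card I ≤ card Image
  |I|≤ = card-injection I Image f g
           (λ w h → ∧-intro (f∈ w (I⊆ w h)) (subst (_∈ I) (sym (gf w (I⊆ w h))) h))
           (λ w h → gf w (I⊆ w h))
  |K|≤|B| : card K ≤ card B
  |K|≤|B| = steinitz (col A) (col A) K B indK (λ w h → basis-spans A T₂ B basis w (K⊆ w h))
  |B|≤ : card B ≤ card NotImage
  |B|≤ = card-mono B NotImage B⊆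
    where
    B⊆ : B ⊆ NotImage
    B⊆ w h with I (g w) in e
    ... | false = ∧-intro (proj₁ basis w h) refl
    ... | true  = ⊥-elim (disjoint w (h , ∧-intro (proj₁ basis w h) e))

card-insert : ∀ {n} (t : Elem n) (B : Sub n) → B t ≡ false → card (insert t B) ≡ suc (card B)
card-insert t B t∉B = trans (card-remove (insert t B) t (insert-new t B)) (cong suc (card-cong same))
  where
  same : ∀ w → (insert t B ─ t) w ≡ B w
  same w with compareW w t
  ... | inj₁ refl rewrite t∉B = cong (λ b → (false ∨ b) ∧ not b) (==W-refl w)
  ... | inj₂ w≢t rewrite ==W-distinct w≢t = trans (∧-identityʳ _) (∨-identityʳ (B w))

transversal-nonφ : ∀ {n} (T : Sub n) → Transversal T → ∀ v → T (v , φ) ≡ false →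
  ∃ λ l → isφ l ≡ false × (v , l) ∈ T
transversal-nonφ T t v v∉T with t v
... | one rewrite v∉T with T (v , χ) in e₁ | T (v , ψ) in e₂
...   | true  | _    = χ , refl , e₁
...   | false | true = ψ , refl , e₂
...   | false | false with one
...     | ()

col-nonφ : ∀ {n} (A : Adj n) {i j} l → isφ l ≡ false → i ≢ j → A i j ≡ true → col A (j , l) i ≡ true
col-nonφ A χ _ i≢j h = h
col-nonφ A ψ _ i≢j h rewrite ==-distinct i≢j | h = refl

CoversΦ : ∀ {n} → Sub n → Sub n → Set
CoversΦ T T′ = ∀ v → (T (v , φ) ∨ T′ (v , φ)) ≡ true

φPart-sizes : ∀ {n} (T T′ : Sub n) → Disjoint T T′ → CoversΦ T T′ → card (φPart T) + card (φPart T′) ≡ n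
φPart-sizes {n} T T′ disj cover =
  trans (cong₂ _+_ (card-φPart T) (card-φPart T′))
  (trans (sym (sumFin-hom (λ v → indicator (T (v , φ))) (λ v → indicator (T′ (v , φ)))))
         (trans (sumFin-cong one) (sumFin-ones n)))
  where
  one : ∀ v → indicator (T (v , φ)) + indicator (T′ (v , φ)) ≡ 1
  one v with T (v , φ) in e | T′ (v , φ) in e′ | cover v
  ... | true  | true  | _ = ⊥-elim (disj _ (e , e′))
  ... | true  | false | _ = refl
  ... | false | true  | _ = refl

-- Under the rank bound, no edge joins two vertices whose φ lies outside T:
-- otherwise φPart T plus a neighbouring χ or ψ of T, together with φPart T′,
-- would give n + 1 independent elements.
no-edge-outside : ∀ {n} (H : Adj n) (T T′ : Sub n) → RankBound H T T′ → DisjTransversals T T′ →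
  CoversΦ T T′ → ∀ {i j} → i ≢ j → H i j ≡ true → T (i , φ) ≡ false → T (j , φ) ≡ false → ⊥
no-edge-outside {n} H T T′ bound (t , _ , disj) cover {i} {j} i≢j hij i∉T j∉T
  with transversal-nonφ T t j j∉T
... | l , nonφ , jl∈T = n≮n n (subst (_≤ n) size (bound I (φPart T′) I⊆T I-indep (φPart-⊆ T′) (φPart-indep H T′)))
  where
  I = insert (j , l) (φPart T)
  I⊆T : I ⊆ T
  I⊆T = insert-⊆ (φPart-⊆ T) jl∈T
  I-indep : Independent H I
  I-indep = extend-indep (col H) (φPart T) (j , l) (unit i) (φPart-indep H T) unit⊥ (trans (unit-· i _) (col-nonφ H l nonφ i≢j hij))
    where
    unit⊥ : ∀ w → w ∈ φPart T → unit i · col H w ≡ false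
    unit⊥ (v , φ) v∈T with compareV i v
    ... | inj₁ refl = ⊥-elim (false≢true (trans (sym i∉T) v∈T))
    ... | inj₂ i≢v  = trans (unit-· i (col H (v , φ))) (==-distinct i≢v)
  size : card I + card (φPart T′) ≡ suc n
  size = trans (cong (_+ card (φPart T′)) (card-insert (j , l) (φPart T) (cong (_∧ T (j , φ)) nonφ)))
               (cong suc (φPart-sizes T T′ disj cover))

RankBound-swap : ∀ {n} {A : Adj n} {T₁ T₂} → RankBound A T₁ T₂ → RankBound A T₂ T₁
RankBound-swap {n} bound I K I⊆ indI K⊆ indK = subst (_≤ n) (+-comm (card K) (card I)) (bound K I K⊆ indK I⊆ indI)

Normal : ∀ {n} → Adj n → Sub n → Sub n → Set
Normal H T₁ T₂ = ∀ v → (H v v ≡ false) × ((T₁ (v , φ) ∨ T₂ (v , φ)) ≡ true)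

normal⇒bipartite : ∀ {n} (H : Adj n) T₁ T₂ → DisjTransversals T₁ T₂ → Normal H T₁ T₂ →
  RankBound H T₁ T₂ → Bipartite H
normal⇒bipartite H T₁ T₂ (t₁ , t₂ , disj) normal bound = (λ v → proj₁ (normal v)) , (λ v → T₁ (v , φ)) , proper
  where
  cover : CoversΦ T₁ T₂
  cover v = proj₂ (normal v)
  outside-T₂ : ∀ v → T₁ (v , φ) ≡ true → T₂ (v , φ) ≡ false
  outside-T₂ v v∈T₁ with T₂ (v , φ) in e
  ... | false = refl
  ... | true  = ⊥-elim (disj _ (v∈T₁ , e))
  proper : ∀ i j → H i j ≡ true → T₁ (i , φ) ≢ T₁ (j , φ)
  proper i j hij same with compareV i j
  ... | inj₁ refl = false≢true (trans (sym (proj₁ (normal i))) hij)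
  ... | inj₂ i≢j with T₁ (j , φ) in ej
  ...   | false = no-edge-outside H T₁ T₂ bound (t₁ , t₂ , disj) cover i≢j hij same ej
  ...   | true  = no-edge-outside H T₂ T₁ (RankBound-swap bound) (t₂ , t₁ , λ w (a , b) → disj w (b , a))
                    (λ v → trans (∨-comm (T₂ (v , φ)) _) (cover v)) i≢j hij (outside-T₂ i same) (outside-T₂ j ej)

module Normalisation (X : PairProperty) (X-invariant : Invariant X) {n} (G : Adj n) where

  record Configuration : Set where
    constructor config
    field
      H     : Adj n
      locEq : LocEq G H
      sym-H : Symmetric H
      T₁ T₂ : Sub n
      disjT : DisjTransversals T₁ T₂
      holds : X H T₁ T₂

  open Configuration

  NormalAt : Configuration → Fin n → Set
  NormalAt C v = (H C v v ≡ false) × ((T₁ C (v , φ) ∨ T₂ C (v , φ)) ≡ true)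

  KeepsNormalOff : Fin n → Configuration → Configuration → Set
  KeepsNormalOff u C C′ = ∀ v → v ≢ u → NormalAt C v → NormalAt C′ v

  apply : (C : Configuration) (H′ : Adj n) → LocEq G H′ → Symmetric H′ → (R : Similar (col (H C)) (col H′)) → Configuration
  apply C H′ locEq′ sym′ R =
    config H′ locEq′ sym′ (T₁ C ∘ʳ π) (T₂ C ∘ʳ π) (disjTransversals-relabel π (disjT C)) (X-invariant R (holds C))
    where open Similar R using (π)

  keeps-at : ∀ (C : Configuration) (H′ : Adj n) locEq′ sym′ (R : Similar (col (H C)) (col H′)) v →
    H′ v v ≡ H C v v → swap (Similar.π R v) φ ≡ φ → NormalAt C v → NormalAt (apply C H′ locEq′ sym′ R) v
  keeps-at C H′ locEq′ sym′ R v same-loop fixes-φ (no-loop , covered) =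
    trans same-loop no-loop ,
    trans (cong (λ l → T₁ C (v , l) ∨ T₂ C (v , l)) fixes-φ) covered

  unloop : ∀ u (C : Configuration) → Σ Configuration λ C′ → KeepsNormalOff u C C′ × (H C′ u u ≡ false)
  unloop u C with H C u u in looped
  ... | false = C , (λ v _ normal → normal) , looped
  ... | true  =
    apply C (opLoop u (H C)) (leLoop u (locEq C)) (opLoop-symmetric (sym-H C) u) (loop-similar (H C) u) ,
    (λ v v≢u → keeps-at C _ (leLoop u (locEq C)) (opLoop-symmetric (sym-H C) u) (loop-similar (H C) u) v (off-u v≢u) (fixes v≢u)) ,
    trans (opLoop-entry u (H C) u u) (cong₂ (λ a b → a xor (b ∧ b)) looped (==-refl u))
    where
    off-u : ∀ {v} → v ≢ u → opLoop u (H C) v v ≡ H C v v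
    off-u v≢u rewrite ==-distinct v≢u = refl
    fixes : ∀ {v} → v ≢ u → swap (loopSwap u v) φ ≡ φ
    fixes v≢u rewrite ==-distinct v≢u = refl

  -- Step 2 at a loopless u: if φ(u) ∉ T₁ ∪ T₂, then ψ(u) ∈ T₁ ∪ T₂ and G^u_s
  -- exchanges φ(u) and ψ(u).
  cover : ∀ u (C : Configuration) → H C u u ≡ false →
    Σ Configuration λ C′ → KeepsNormalOff u C C′ × NormalAt C′ u
  cover u C no-loop with T₁ C (u , φ) ∨ T₂ C (u , φ) in covered
  ... | true  = C , (λ v _ normal → normal) , no-loop , covered
  ... | false =
    apply C (opS u (H C)) (leS u (locEq C)) (opS-symmetric (sym-H C) u) (s-similar (H C) (sym-H C) u) ,
    (λ v v≢u → keeps-at C _ (leS u (locEq C)) (opS-symmetric (sym-H C) u) (s-similar (H C) (sym-H C) u) v (off-u v) (fixes v≢u)) ,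
    trans (off-u u) no-loop , ψ-covered
    where
    off-u : ∀ v → opS u (H C) v v ≡ H C v v
    off-u v rewrite ==-refl v = refl
    fixes : ∀ {v} → v ≢ u → swap (sSwap (H C) u v) φ ≡ φ
    fixes v≢u rewrite ==-distinct v≢u = nbr-fixes-φ _
      where
      nbr-fixes-φ : ∀ b → swap (if b then swapχψ else keep) φ ≡ φ
      nbr-fixes-φ true  = refl
      nbr-fixes-φ false = refl
    ψ-covered : (T₁ C (u , swap (sSwap (H C) u u) φ) ∨ T₂ C (u , swap (sSwap (H C) u u) φ)) ≡ true
    ψ-covered rewrite ==-refl u | no-loop with T₁ C (u , φ) in e₁ | T₂ C (u , φ) in e₂
    ... | false | false with disjT C
    ...   | t₁ , t₂ , disj with transversal-nonφ (T₁ C) t₁ u e₁ | transversal-nonφ (T₂ C) t₂ u e₂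
    ...     | ψ , _ , h | _         = ∨-introˡ h
    ...     | χ , _ , h | ψ , _ , h′ = ∨-introʳ {T₁ C (u , ψ)} h′
    ...     | χ , _ , h | χ , _ , h′ = ⊥-elim (disj _ (h , h′))

  normalise-vertex : ∀ u (C : Configuration) → Σ Configuration λ C′ → KeepsNormalOff u C C′ × NormalAt C′ u
  normalise-vertex u C with unloop u C
  ... | C₁ , keeps₁ , no-loop with cover u C₁ no-loop
  ...   | C₂ , keeps₂ , normal = C₂ , (λ v v≢u → keeps₂ v v≢u ∘ keeps₁ v v≢u) , normal

  normalise-below : ∀ m → m ≤ n → Configuration → Σ Configuration λ C → ∀ v → toℕ v < m → NormalAt C v
  normalise-below zero    _   C = C , λ v ()
  normalise-below (suc m) m<n C with normalise-below m (<⇒≤ m<n) C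
  ... | C₁ , below with normalise-vertex (fromℕ< m<n) C₁
  ...   | C₂ , keeps , normal = C₂ , below′
    where
    below′ : ∀ v → toℕ v < suc m → NormalAt C₂ v
    below′ v v<1+m with compareV v (fromℕ< m<n)
    ... | inj₁ refl = normal
    ... | inj₂ v≢m  = keeps v v≢m (below v (≤∧≢⇒< (s≤s⁻¹ v<1+m)
                        (λ v≡m → v≢m (toℕ-injective (trans v≡m (sym (toℕ-fromℕ< m<n)))))))

  normal-form : Configuration → Σ Configuration λ C → Normal (H C) (T₁ C) (T₂ C)
  normal-form C with normalise-below n ≤-refl C
  ... | C′ , below = C′ , λ v → below v (toℕ<n v)

cond1⇔pairCondition : (X : PairProperty) → Invariant X →
  (∀ {n} (H : Adj n) → Symmetric H → ∀ c → Bipartition.Proper H c →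
     X H (Bipartition.side H c) (Bipartition.side H (Bipartition.flip H c))) →
  (∀ {n} {A : Adj n} {T₁ T₂} → DisjTransversals T₁ T₂ → X A T₁ T₂ → RankBound A T₁ T₂) →
  ∀ {n} (G : Adj n) → Symmetric G → Cond1 G ⇔ PairCondition X G
cond1⇔pairCondition X X-invariant bipartite⇒X X⇒bound G sym-G = mk⇔ forward backward
  where
  open Normalisation X X-invariant G using (config; normal-form)
  -- a bipartite H satisfies the condition, which local equivalence carries back to G
  forward : Cond1 G → PairCondition X G
  forward (H , locEq , _ , c , proper) =
    LocEq-reflects (PairCondition X) (PairCondition-transport X-invariant) sym-G locEq
      (side c , side (flip c) , (side-transversal c , side-transversal (flip c) , sides-disjoint c) ,
       bipartite⇒X H sym-H c proper)
    where
    sym-H = LocEq-symmetric sym-G locEq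
    open Bipartition H
  -- the normal form of the condition is bipartite
  backward : PairCondition X G → Cond1 G
  backward (T₁ , T₂ , disjT , x) with normal-form (config G leRefl sym-G T₁ T₂ disjT x)
  ... | config H locEq _ T₁′ T₂′ disjT′ x′ , normal =
    H , locEq , normal⇒bipartite H T₁′ T₂′ disjT′ normal (X⇒bound disjT′ x′)

corollary44 : (n : ℕ) (G : Adj n) → Symmetric G →
    (Cond1 G ⇔ Cond2 G) × (Cond1 G ⇔ Cond3 G) × (Cond1 G ⇔ Cond4 G)
corollary44 n G sym-G =
  cond1⇔pairCondition RanksSumTo ranks-invariant
    (λ H _ → Bipartition.ranks H)
    (λ {_} {A} {T₁} {T₂} _ → ranks⇒bound A T₁ T₂) G sym-G ,
  cond1⇔pairCondition DirectSumSplit directSum-invariant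
    (λ H _ → Bipartition.sides-directSum H)
    (λ {_} {A} {T₁} {T₂} (_ , _ , disj) → directSum⇒bound A T₁ T₂ disj) G sym-G ,
  cond1⇔pairCondition IsoToDual isoToDual-invariant
    (λ H sym-H c proper → SidesDual.sides-isoToDual H sym-H c proper)
    (λ {_} {A} {T₁} {T₂} (_ , t₂ , _) → isoToDual⇒bound A T₁ T₂ t₂) G sym-G
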